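{- Let $F_q$ be the finite field with $q$ elements, $V=F_q^n$, and $1<k<n-1$. Let $U$ be a projective code $[n,k+1]_q$ with generator matrix $M$ whose rows $v_1,\dots,v_{k+1}$ form a basis of $U$ and whose columns are $l_1,\dots,l_n\in F_q^{k+1}$. Let $W$ be the set of all non-zero vectors $w\in F_q^{k+1}$ not proportional to any column of $M$, for $w=(w_1,\dots,w_{k+1})\in W$ let $C(w)=\{\sum_{i=1}^{k+1}a_iv_i : a_i\in F_q,\ \sum_{i=1}^{k+1}a_iw_i=0\}$, and let $Y\subseteq W$ be the set of all $w\in W$ such that $w\neq\alpha l_i+\beta l_j$ for all $\alpha,\beta\in F_q\setminus\{0\}$ and all columns $l_i,l_j$ of $M$. Let $\langle U]^{\Pi}_k$ be the set of all projective codes $[n,k]_q$ contained in $U$, and let $\langle Y\rangle$ denote the subspace of $F_q^{k+1}$ spanned by $Y$. Then $\langle U]^{\Pi}_k$ is contained in a line of $\mathcal G_k(V)$ if and only if $\dim\langle Y\rangle\le 2$. Moreover, $\langle U]^{\Pi}_k$ is contained in (a) all lines of $\mathcal G_k(V)$ if and only if $\dim\langle Y\rangle=0$; (b) precisely $[k]_q[n-k]_q$ lines of $\mathcal G_k(V)$ if and only if $\dim\langle Y\rangle=1$; (c) precisely one line of $\mathcal G_k(V)$ if and only if $\dim\langle Y\rangle=2$, and in this case this line is $[\bigcap_{y\in Y}C(y),U]_k$.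
   Context: A linear code $[n,k]_q$ is a $k$-dimensional subspace of $V=F_q^n$; a generator matrix is a matrix whose rows form a basis of the code. A linear code is projective if its generator matrices contain no zero columns and no two proportional columns. $\mathcal G_k(V)$ denotes the set of all $k$-dimensional subspaces of $V$. For subspaces $S\subset U'$ of $V$ with $\dim S<k<\dim U'$, $[S,U']_k$ is the set of all $k$-dimensional subspaces $K$ with $S\subset K\subset U'$; when $\dim S=k-1$ and $\dim U'=k+1$, $[S,U']_k$ is called a line of $\mathcal G_k(V)$. $[m]_q=(q^m-1)/(q-1)$. -}

module Defs where

import Level
open import Level using (Level; 0ℓ) renaming (suc to lsuc)
open import Data.Nat using (ℕ; zero; suc; _^_; _∸_; _≤_) renaming (_+_ to _+ℕ_; _*_ to _*ℕ_)
open import Data.Fin using (Fin; zero; suc)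
open import Data.Product using (Σ; ∃; ∃-syntax; _×_; _,_)
open import Data.Sum using (_⊎_)
open import Data.Empty using (⊥)
open import Relation.Nullary using (¬_)
open import Relation.Binary.PropositionalEquality using (_≡_)
open import Relation.Binary.Definitions using (DecidableEquality)
open import Algebra.Structures using (IsCommutativeRing)
open import Function.Bundles using (_↔_)

record FiniteField : Set₁ where
  infixl 6 _+_
  infixl 7 _*_
  field
    Carrier : Set
    _+_ _*_ : Carrier → Carrier → Carrier
    -_      : Carrier → Carrier
    0# 1#   : Carrier
    isCommutativeRing : IsCommutativeRing _≡_ _+_ _*_ -_ 0# 1#
    0≢1     : ¬ (0# ≡ 1#)
    inverse : ∀ x → ¬ (x ≡ 0#) → Σ Carrier (λ y → x * y ≡ 1#)
    _≟_     : DecidableEquality Carrier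
    q       : ℕ
    enum    : Fin q ↔ Carrier

-- Gaussian number [m]_q = (q^m - 1)/(q - 1) = 1 + q + ... + q^(m-1)

gauss : ℕ → ℕ → ℕ
gauss q zero    = zero
gauss q (suc m) = q ^ m +ℕ gauss q m

module LinAlg (𝔽 : FiniteField) where
  open FiniteField 𝔽

  Vec : ℕ → Set
  Vec n = Fin n → Carrier

  _≈_ : ∀ {n} → Vec n → Vec n → Set
  v ≈ w = ∀ i → v i ≡ w i

  0v : ∀ {n} → Vec n
  0v _ = 0#

  _·_ : ∀ {n} → Carrier → Vec n → Vec n
  (c · v) i = c * v i

  _⊕_ : ∀ {n} → Vec n → Vec n → Vec n
  (v ⊕ w) i = v i + w i

  sumF : ∀ {m} → (Fin m → Carrier) → Carrier
  sumF {zero}  f = 0#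
  sumF {suc m} f = f zero + sumF (λ i → f (suc i))

  lincomb : ∀ {m n} → (Fin m → Carrier) → (Fin m → Vec n) → Vec n
  lincomb c B j = sumF (λ i → c i * B i j)

  Pred : ℕ → Set₁
  Pred n = Vec n → Set

  _⊆_ : ∀ {n} → Pred n → Pred n → Set
  P ⊆ Q = ∀ v → P v → Q v

  _⇔_ : Set → Set → Set
  A ⇔ B = (A → B) × (B → A)

  Span : ∀ {m n} → (Fin m → Vec n) → Pred n
  Span B v = Σ (Fin _ → Carrier) (λ c → v ≈ lincomb c B)

  LinIndep : ∀ {m n} → (Fin m → Vec n) → Set
  LinIndep B = ∀ c → lincomb c B ≈ 0v → ∀ i → c i ≡ 0#

  HasDim : ∀ {n} → Pred n → ℕ → Set
  HasDim {n} P d = Σ (Fin d → Vec n) (λ B → LinIndep B × (∀ v → P v ⇔ Span B v))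

  SpanSet : ∀ {n} → Pred n → Pred n
  SpanSet {n} Y v = Σ ℕ (λ m → Σ (Fin m → Vec n) (λ ys →
                      (∀ i → Y (ys i)) × Span ys v))

  column : ∀ {m n} → (Fin m → Vec n) → Fin n → Vec m
  column G j i = G i j

  Proportional : ∀ {m} → Vec m → Vec m → Set
  Proportional w l = Σ Carrier (λ c → w ≈ (c · l))

  ProjectiveMatrix : ∀ {m n} → (Fin m → Vec n) → Set
  ProjectiveMatrix G =
    (∀ j → ¬ (column G j ≈ 0v)) ×
    (∀ i j → ¬ (i ≡ j) → ¬ Proportional (column G i) (column G j))

  ProjCode : ∀ {n} → ℕ → Pred n → Set
  ProjCode {n} k K = Σ (Fin k → Vec n) (λ G →
    LinIndep G × ProjectiveMatrix G × (∀ v → K v ⇔ Span G v))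

  -- lines of G_k(V): [S,U']_k with dim S = k-1, dim U' = k+1
  record Line (n k : ℕ) : Set₁ where
    field
      S  : Pred n
      U' : Pred n
      dimS  : HasDim S (k ∸ 1)
      dimU' : HasDim U' (suc k)
      S⊆U'  : S ⊆ U'

  InInterval : ∀ {n} → Pred n → Pred n → ℕ → Pred n → Set
  InInterval S U' k K = HasDim K k × S ⊆ K × K ⊆ U'

  InLine : ∀ {n k} → Line n k → Pred n → Set
  InLine {k = k} L K = InInterval (Line.S L) (Line.U' L) k K

  LineEq : ∀ {n k} → Line n k → Line n k → Set₁
  LineEq {n} L L' = ∀ (K : Pred n) → InLine L K ⇔ InLine L' K

  InProjPart : ∀ {n} → Pred n → ℕ → Pred n → Set
  InProjPart U k K = ProjCode k K × K ⊆ U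

  ContainedIn : ∀ {n k} → Pred n → Line n k → Set₁
  ContainedIn {n} {k} U L = ∀ (K : Pred n) → InProjPart U k K → InLine L K

  _∈ᴸ_ : ∀ {n k} → Line n k → (Σ ℕ λ N → Fin N → Line n k) → Set₁
  L ∈ᴸ (N , Ls) = Σ (Fin N) (λ i → LineEq L (Ls i))

  ContainedInExactly : ∀ {n k} → Pred n → ℕ → Set₁
  ContainedInExactly {n} {k} U N = Σ (Fin N → Line n k) (λ Ls →
    (∀ i → ContainedIn U (Ls i)) ×
    (∀ i j → LineEq (Ls i) (Ls j) → i ≡ j) ×
    (∀ L → ContainedIn U L → L ∈ᴸ (N , Ls)))

  module _ {m n : ℕ} (M : Fin m → Vec n) where

    InW : Pred m
    InW w = ¬ (w ≈ 0v) × (∀ j → ¬ Proportional w (column M j))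

    C : Vec m → Pred n
    C w v = Σ (Fin m → Carrier) (λ a →
              (sumF (λ i → a i * w i) ≡ 0#) × v ≈ lincomb a M)

    InY : Pred m
    InY w = InW w × (∀ (α β : Carrier) → ¬ (α ≡ 0#) → ¬ (β ≡ 0#) →
              ∀ i j → ¬ (w ≈ ((α · column M i) ⊕ (β · column M j))))

    ⋂C : Pred n
    ⋂C v = ∀ y → InY y → C y v

_⇔₁_ : ∀ {a b : Level} → Set a → Set b → Set (a Level.⊔ b)
A ⇔₁ B = (A → B) × (B → A)

module Submission where

-- In the coordinates of the basis v₁, …, v_{k+1}, every [n,k] subcode of U is the hyperplane
-- C(y) = y^⊥ of U for some y ≠ 0, and C(y) is projective exactly when y ∈ Y: a dependency between
-- two columns of a generator matrix of C(y) makes l_a − c·l_b a multiple of y.  A line [S,U']_k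
-- contains every C(y), y ∈ Y, iff S ⊆ ⋂ C(y) and Σ C(y) ⊆ U'.  So if Y = ∅ every line qualifies;
-- if ⟨Y⟩ = ⟨y⟩ the qualifying lines are the lines through C(y), which correspond to pairs
-- (hyperplane of C(y), point of V/C(y)), i.e. there are [k]_q [n-k]_q of them; if Y contains two
-- independent y₁, y₂ then S = C(y₁) ∩ C(y₂) and U' = C(y₁) + C(y₂) = U are forced, and S ⊆ C(y)
-- then forces y ∈ ⟨y₁, y₂⟩ for every y ∈ Y, so a third independent vector of Y rules out any line.
-- Since [k]_q [n-k]_q ≥ 2 and the lines through a fixed k-space do not exhaust all lines, the four
-- cases are told apart by the number of qualifying lines, which gives the stated equivalences.

open import Level using (0ℓ; _⊔_) renaming (suc to lsuc)
open import Data.Nat as ℕ using (ℕ; zero; suc; z≤n; s≤s; _∸_; _<_; _≤_; _^_)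
import Data.Nat.Properties as ℕP
open import Data.Fin using (Fin; zero; suc; punchIn; _↑ˡ_; _↑ʳ_; splitAt; join; finToFun; funToFin; remQuot; combine)
import Data.Fin.Properties as FinP
open import Data.Vec.Functional using (_∷_; []; insertAt)
open import Data.Vec.Functional.Properties using (insertAt-lookup; insertAt-punchIn)
open import Data.Product using (Σ; _×_; _,_; proj₁; proj₂; uncurry′)
open import Data.Sum using (_⊎_; inj₁; inj₂)
open import Data.Empty using (⊥; ⊥-elim)
open import Relation.Nullary using (¬_; Dec; yes; no)
open import Relation.Nullary.Decidable using (map′; ¬?; _×-dec_; _→-dec_; decidable-stable)
open import Relation.Binary.PropositionalEquality
open import Function.Bundles using (Inverse)
open import Algebra.Bundles using (CommutativeRing)
import Algebra.Properties.Ring as RingProperties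
import Algebra.Properties.CommutativeSemigroup as CommutativeSemigroupProperties

open import Defs

module FieldProperties (𝔽 : FiniteField) where
  open FiniteField 𝔽
  open ≡-Reasoning

  commutativeRing : CommutativeRing 0ℓ 0ℓ
  commutativeRing = record { isCommutativeRing = isCommutativeRing }

  open CommutativeRing commutativeRing public
    using ( +-assoc; +-comm; +-identityˡ; +-identityʳ; -‿inverseʳ
          ; *-assoc; *-comm; *-identityˡ; *-identityʳ; distribˡ; distribʳ; zeroˡ; zeroʳ )
  open RingProperties (CommutativeRing.ring commutativeRing) public
    using (-0#≈0#; -‿involutive; -‿distribˡ-*; -‿distribʳ-*; -‿+-comm; +-inverseʳ-unique; x∙y⁻¹≈ε⇒x≈y)
  open CommutativeSemigroupProperties (CommutativeRing.+-commutativeSemigroup commutativeRing) public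
    using () renaming (interchange to +-interchange)
  open CommutativeSemigroupProperties (CommutativeRing.*-commutativeSemigroup commutativeRing) public
    using () renaming (x∙yz≈y∙xz to *-swapˡ)

  1≢0 : ¬ (1# ≡ 0#)
  1≢0 eq = 0≢1 (sym eq)

  inv : ∀ x → ¬ (x ≡ 0#) → Carrier
  inv x x≢0 = proj₁ (inverse x x≢0)

  inv-inverseʳ : ∀ x (x≢0 : ¬ (x ≡ 0#)) → x * inv x x≢0 ≡ 1#
  inv-inverseʳ x x≢0 = proj₂ (inverse x x≢0)

  inv-inverseˡ : ∀ x (x≢0 : ¬ (x ≡ 0#)) → inv x x≢0 * x ≡ 1#
  inv-inverseˡ x x≢0 = trans (*-comm _ x) (inv-inverseʳ x x≢0)

  inv-nonzero : ∀ x (x≢0 : ¬ (x ≡ 0#)) → ¬ (inv x x≢0 ≡ 0#)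
  inv-nonzero x x≢0 eq = 0≢1 (begin
    0#               ≡⟨ sym (zeroʳ x) ⟩
    x * 0#           ≡⟨ cong (x *_) (sym eq) ⟩
    x * inv x x≢0    ≡⟨ inv-inverseʳ x x≢0 ⟩
    1#               ∎)

  inv-cancelˡ : ∀ a (a≢0 : ¬ (a ≡ 0#)) x → inv a a≢0 * (a * x) ≡ x
  inv-cancelˡ a a≢0 x = begin
    inv a a≢0 * (a * x)  ≡⟨ sym (*-assoc _ a x) ⟩
    (inv a a≢0 * a) * x  ≡⟨ cong (_* x) (inv-inverseˡ a a≢0) ⟩
    1# * x               ≡⟨ *-identityˡ x ⟩
    x                    ∎

  *-cancelˡ-nonzero : ∀ a {x y} → ¬ (a ≡ 0#) → a * x ≡ a * y → x ≡ y
  *-cancelˡ-nonzero a {x} {y} a≢0 eq = begin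
    x                    ≡⟨ sym (inv-cancelˡ a a≢0 x) ⟩
    inv a a≢0 * (a * x)  ≡⟨ cong (inv a a≢0 *_) eq ⟩
    inv a a≢0 * (a * y)  ≡⟨ inv-cancelˡ a a≢0 y ⟩
    y                    ∎

  *-zero-nonzeroˡ : ∀ a {x} → ¬ (a ≡ 0#) → a * x ≡ 0# → x ≡ 0#
  *-zero-nonzeroˡ a a≢0 eq = *-cancelˡ-nonzero a a≢0 (trans eq (sym (zeroʳ a)))

  *-nonzero : ∀ {a b} → ¬ (a ≡ 0#) → ¬ (b ≡ 0#) → ¬ (a * b ≡ 0#)
  *-nonzero {a} a≢0 b≢0 eq = b≢0 (*-zero-nonzeroˡ a a≢0 eq)

  -‿nonzero : ∀ {x} → ¬ (x ≡ 0#) → ¬ (- x ≡ 0#)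
  -‿nonzero {x} x≢0 eq = x≢0 (trans (sym (-‿involutive x)) (trans (cong -_ eq) -0#≈0#))

  +-neg-cancelʳ : ∀ a b → (a + b) + - b ≡ a
  +-neg-cancelʳ a b = trans (+-assoc a b (- b)) (trans (cong (a +_) (-‿inverseʳ b)) (+-identityʳ a))

  solve-for-first : ∀ a b x y (a≢0 : ¬ (a ≡ 0#)) → a * x + b * y ≡ 0# → x ≡ - (inv a a≢0 * b) * y
  solve-for-first a b x y a≢0 eq = begin
    x                            ≡⟨ sym (inv-cancelˡ a a≢0 x) ⟩
    inv a a≢0 * (a * x)          ≡⟨ cong (inv a a≢0 *_) (+-inverseʳ-unique (b * y) (a * x) (trans (+-comm _ _) eq)) ⟩
    inv a a≢0 * - (b * y)        ≡⟨ sym (-‿distribʳ-* _ _) ⟩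
    - (inv a a≢0 * (b * y))      ≡⟨ cong -_ (sym (*-assoc _ b y)) ⟩
    - ((inv a a≢0 * b) * y)      ≡⟨ -‿distribˡ-* _ y ⟩
    - (inv a a≢0 * b) * y        ∎

module Vectors (𝔽 : FiniteField) where
  open FiniteField 𝔽
  open LinAlg 𝔽
  open FieldProperties 𝔽 public
  open ≡-Reasoning

  Fam : ℕ → ℕ → Set
  Fam m n = Fin m → Vec n

  ≈-refl : ∀ {n} {v : Vec n} → v ≈ v
  ≈-refl i = refl

  ≈-sym : ∀ {n} {v w : Vec n} → v ≈ w → w ≈ v
  ≈-sym p i = sym (p i)

  ≈-trans : ∀ {n} {u v w : Vec n} → u ≈ v → v ≈ w → u ≈ w
  ≈-trans p q i = trans (p i) (q i)

  sumF-cong : ∀ {m} {f g : Fin m → Carrier} → (∀ i → f i ≡ g i) → sumF f ≡ sumF g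
  sumF-cong {zero}  eq = refl
  sumF-cong {suc m} eq = cong₂ _+_ (eq zero) (sumF-cong (λ i → eq (suc i)))

  sumF-zero : ∀ {m} {f : Fin m → Carrier} → (∀ i → f i ≡ 0#) → sumF f ≡ 0#
  sumF-zero {zero}  eq = refl
  sumF-zero {suc m} eq = trans (cong₂ _+_ (eq zero) (sumF-zero (λ i → eq (suc i)))) (+-identityˡ 0#)

  sumF-+ : ∀ {m} (f g : Fin m → Carrier) → sumF (λ i → f i + g i) ≡ sumF f + sumF g
  sumF-+ {zero}  f g = sym (+-identityˡ 0#)
  sumF-+ {suc m} f g = trans (cong ((f zero + g zero) +_) (sumF-+ (λ i → f (suc i)) (λ i → g (suc i))))
                             (+-interchange _ _ _ _)

  *-distribˡ-sumF : ∀ {m} c (f : Fin m → Carrier) → c * sumF f ≡ sumF (λ i → c * f i)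
  *-distribˡ-sumF {zero}  c f = zeroʳ c
  *-distribˡ-sumF {suc m} c f = trans (distribˡ c _ _) (cong ((c * f zero) +_) (*-distribˡ-sumF c (λ i → f (suc i))))

  *-distribʳ-sumF : ∀ {m} c (f : Fin m → Carrier) → sumF f * c ≡ sumF (λ i → f i * c)
  *-distribʳ-sumF c f = trans (*-comm _ c) (trans (*-distribˡ-sumF c f) (sumF-cong (λ i → *-comm c (f i))))

  -‿distrib-sumF : ∀ {m} (f : Fin m → Carrier) → - sumF f ≡ sumF (λ i → - f i)
  -‿distrib-sumF {zero}  f = -0#≈0#
  -‿distrib-sumF {suc m} f = trans (sym (-‿+-comm _ _)) (cong ((- f zero) +_) (-‿distrib-sumF (λ i → f (suc i))))

  sumF-comm : ∀ {m n} (f : Fin m → Fin n → Carrier) →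
              sumF (λ i → sumF (λ j → f i j)) ≡ sumF (λ j → sumF (λ i → f i j))
  sumF-comm {zero}  {n} f = sym (sumF-zero {n} (λ j → refl))
  sumF-comm {suc m} {n} f = begin
    sumF (f zero) + sumF (λ i → sumF (f (suc i)))          ≡⟨ cong (sumF (f zero) +_) (sumF-comm (λ i → f (suc i))) ⟩
    sumF (f zero) + sumF (λ j → sumF (λ i → f (suc i) j))  ≡⟨ sym (sumF-+ (f zero) _) ⟩
    sumF (λ j → f zero j + sumF (λ i → f (suc i) j))       ∎

  sumF-punchIn : ∀ {m} (i : Fin (suc m)) (f : Fin (suc m) → Carrier) →
                 sumF f ≡ f i + sumF (λ j → f (punchIn i j))
  sumF-punchIn zero f = refl
  sumF-punchIn {suc m} (suc i) f = begin
    f zero + sumF (λ j → f (suc j))  ≡⟨ cong (f zero +_) (sumF-punchIn i (λ j → f (suc j))) ⟩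
    f zero + (f (suc i) + rest)      ≡⟨ sym (+-assoc _ _ rest) ⟩
    (f zero + f (suc i)) + rest      ≡⟨ cong (_+ rest) (+-comm _ _) ⟩
    (f (suc i) + f zero) + rest      ≡⟨ +-assoc _ _ rest ⟩
    f (suc i) + (f zero + rest)      ∎
    where rest = sumF (λ j → f (suc (punchIn i j)))

  sumF-split : ∀ r {t} (f : Fin (r ℕ.+ t) → Carrier) →
               sumF f ≡ sumF (λ i → f (i ↑ˡ t)) + sumF (λ i → f (r ↑ʳ i))
  sumF-split zero    f = sym (+-identityˡ _)
  sumF-split (suc r) f = trans (cong (f zero +_) (sumF-split r (λ i → f (suc i)))) (sym (+-assoc _ _ _))

  e : ∀ {m} → Fin m → Vec m
  e zero    zero    = 1#
  e zero    (suc j) = 0#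
  e (suc i) zero    = 0#
  e (suc i) (suc j) = e i j

  e-sym : ∀ {m} (i j : Fin m) → e i j ≡ e j i
  e-sym zero    zero    = refl
  e-sym zero    (suc j) = refl
  e-sym (suc i) zero    = refl
  e-sym (suc i) (suc j) = e-sym i j

  e-diag : ∀ {m} (i : Fin m) → e i i ≡ 1#
  e-diag zero    = refl
  e-diag (suc i) = e-diag i

  sumF-eˡ : ∀ {m} (i : Fin m) (f : Fin m → Carrier) → sumF (λ j → e i j * f j) ≡ f i
  sumF-eˡ {suc m} zero f = begin
    1# * f zero + sumF (λ j → 0# * f (suc j))  ≡⟨ cong₂ _+_ (*-identityˡ _) (sumF-zero {m} (λ j → zeroˡ _)) ⟩
    f zero + 0#                                ≡⟨ +-identityʳ _ ⟩
    f zero                                     ∎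
  sumF-eˡ {suc m} (suc i) f = trans (cong₂ _+_ (zeroˡ _) (sumF-eˡ i (λ j → f (suc j)))) (+-identityˡ _)

  sumF-eʳ : ∀ {m} (i : Fin m) (f : Fin m → Carrier) → sumF (λ j → f j * e j i) ≡ f i
  sumF-eʳ i f = trans (sumF-cong (λ j → trans (*-comm _ _) (cong (_* f j) (e-sym j i)))) (sumF-eˡ i f)

  dot : ∀ {m} → Vec m → Vec m → Carrier
  dot a w = sumF (λ i → a i * w i)

  dot-comm : ∀ {m} (a w : Vec m) → dot a w ≡ dot w a
  dot-comm a w = sumF-cong (λ i → *-comm (a i) (w i))

  dot-cong : ∀ {m} {a a' w w' : Vec m} → a ≈ a' → w ≈ w' → dot a w ≡ dot a' w'
  dot-cong a≈a' w≈w' = sumF-cong (λ i → cong₂ _*_ (a≈a' i) (w≈w' i))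

  dot-congˡ : ∀ {m} {a a' : Vec m} (w : Vec m) → a ≈ a' → dot a w ≡ dot a' w
  dot-congˡ w a≈a' = dot-cong a≈a' (≈-refl {v = w})

  dot-congʳ : ∀ {m} (a : Vec m) {w w' : Vec m} → w ≈ w' → dot a w ≡ dot a w'
  dot-congʳ a w≈w' = dot-cong (≈-refl {v = a}) w≈w'

  dot-zeroʳ : ∀ {n} (w : Vec n) → dot w 0v ≡ 0#
  dot-zeroʳ w = sumF-zero (λ i → zeroʳ (w i))

  dot-·ʳ : ∀ {m} (a w : Vec m) μ → dot a (μ · w) ≡ μ * dot a w
  dot-·ʳ a w μ = trans (sumF-cong (λ i → *-swapˡ (a i) μ (w i))) (sym (*-distribˡ-sumF μ (λ i → a i * w i)))

  dot-⊕ʳ : ∀ {m} (x u w : Vec m) → dot x (u ⊕ w) ≡ dot x u + dot x w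
  dot-⊕ʳ x u w = trans (sumF-cong (λ i → distribˡ (x i) (u i) (w i))) (sumF-+ (λ i → x i * u i) (λ i → x i * w i))

  dot-linearʳ : ∀ {m} (x u w : Vec m) α β → dot x ((α · u) ⊕ (β · w)) ≡ α * dot x u + β * dot x w
  dot-linearʳ x u w α β = trans (dot-⊕ʳ x (α · u) (β · w)) (cong₂ _+_ (dot-·ʳ x u α) (dot-·ʳ x w β))

  lincomb-cong : ∀ {m n} {c c' : Vec m} {B B' : Fam m n} → c ≈ c' → (∀ i → B i ≈ B' i) →
                 lincomb c B ≈ lincomb c' B'
  lincomb-cong c≈c' B≈B' j = sumF-cong (λ i → cong₂ _*_ (c≈c' i) (B≈B' i j))

  lincomb-congˡ : ∀ {m n} {c c' : Vec m} (B : Fam m n) → c ≈ c' → lincomb c B ≈ lincomb c' B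
  lincomb-congˡ B c≈c' = lincomb-cong c≈c' (λ i → ≈-refl {v = B i})

  lincomb-zero : ∀ {m n} (B : Fam m n) → lincomb 0v B ≈ 0v
  lincomb-zero {m} B j = sumF-zero {m} (λ i → zeroˡ _)

  lincomb-+ : ∀ {m n} (c d : Vec m) (B : Fam m n) → lincomb (c ⊕ d) B ≈ (lincomb c B ⊕ lincomb d B)
  lincomb-+ c d B j = trans (sumF-cong (λ i → distribʳ (B i j) (c i) (d i))) (sumF-+ (λ i → c i * B i j) (λ i → d i * B i j))

  lincomb-· : ∀ {m n} x (c : Vec m) (B : Fam m n) → lincomb (x · c) B ≈ (x · lincomb c B)
  lincomb-· x c B j = trans (sumF-cong (λ i → *-assoc x (c i) (B i j))) (sym (*-distribˡ-sumF x (λ i → c i * B i j)))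

  lincomb-neg : ∀ {m n} (c : Vec m) (B : Fam m n) j → lincomb (λ i → - c i) B j ≡ - lincomb c B j
  lincomb-neg c B j = trans (sumF-cong (λ i → sym (-‿distribˡ-* (c i) (B i j)))) (sym (-‿distrib-sumF (λ i → c i * B i j)))

  lincomb-e : ∀ {m n} (i : Fin m) (B : Fam m n) → lincomb (e i) B ≈ B i
  lincomb-e i B j = sumF-eˡ i (λ l → B l j)

  lincomb-∘ : ∀ {m d n} (c : Vec m) (A : Fam m d) (G : Fam d n) →
              lincomb c (λ i → lincomb (A i) G) ≈ lincomb (lincomb c A) G
  lincomb-∘ c A G j = begin
    sumF (λ i → c i * sumF (λ l → A i l * G l j))    ≡⟨ sumF-cong (λ i → *-distribˡ-sumF (c i) (λ l → A i l * G l j)) ⟩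
    sumF (λ i → sumF (λ l → c i * (A i l * G l j)))  ≡⟨ sumF-comm (λ i l → c i * (A i l * G l j)) ⟩
    sumF (λ l → sumF (λ i → c i * (A i l * G l j)))  ≡⟨ sumF-cong (λ l → sumF-cong (λ i → sym (*-assoc (c i) (A i l) (G l j)))) ⟩
    sumF (λ l → sumF (λ i → (c i * A i l) * G l j))  ≡⟨ sumF-cong (λ l → sym (*-distribʳ-sumF (G l j) (λ i → c i * A i l))) ⟩
    sumF (λ l → sumF (λ i → c i * A i l) * G l j)    ∎

  dot-lincombʳ : ∀ {m n} (w : Vec n) (c : Vec m) (G : Fam m n) →
                 dot w (lincomb c G) ≡ sumF (λ i → c i * dot w (G i))
  dot-lincombʳ w c G = begin
    sumF (λ l → w l * sumF (λ i → c i * G i l))    ≡⟨ sumF-cong (λ l → *-distribˡ-sumF (w l) (λ i → c i * G i l)) ⟩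
    sumF (λ l → sumF (λ i → w l * (c i * G i l)))  ≡⟨ sumF-comm (λ l i → w l * (c i * G i l)) ⟩
    sumF (λ i → sumF (λ l → w l * (c i * G i l)))  ≡⟨ sumF-cong (λ i → sumF-cong (λ l → *-swapˡ (w l) (c i) (G i l))) ⟩
    sumF (λ i → sumF (λ l → c i * (w l * G i l)))  ≡⟨ sumF-cong (λ i → sym (*-distribˡ-sumF (c i) (λ l → w l * G i l))) ⟩
    sumF (λ i → c i * dot w (G i))                 ∎

  dot-lincombˡ : ∀ {m n} (w : Vec n) (c : Vec m) (G : Fam m n) →
                 dot (lincomb c G) w ≡ sumF (λ i → c i * dot (G i) w)
  dot-lincombˡ w c G =
    trans (dot-comm _ w) (trans (dot-lincombʳ w c G) (sumF-cong (λ i → cong (c i *_) (dot-comm w (G i)))))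

  Resp : ∀ {n} → Pred n → Set
  Resp P = ∀ {u v} → u ≈ v → P u → P v

  Span-resp : ∀ {m n} (B : Fam m n) → Resp (Span B)
  Span-resp B u≈v (c , u≈cB) = c , ≈-trans (≈-sym u≈v) u≈cB

  Span-· : ∀ {m n} (B : Fam m n) x {u} → Span B u → Span B (x · u)
  Span-· B x (c , p) = (x · c) , λ j → trans (cong (x *_) (p j)) (sym (lincomb-· x c B j))

  Span-member : ∀ {m n} (B : Fam m n) i → Span B (B i)
  Span-member B i = e i , ≈-sym (lincomb-e i B)

  Span-lincomb : ∀ {m n} (B : Fam m n) c → Span B (lincomb c B)
  Span-lincomb B c = c , ≈-refl

  Span-mono : ∀ {m d n} (B : Fam m n) (G : Fam d n) → (∀ i → Span G (B i)) → Span B ⊆ Span G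
  Span-mono B G B⊆G v (c , p) =
    lincomb c (λ i → proj₁ (B⊆G i)) ,
    ≈-trans p (≈-trans (lincomb-cong ≈-refl (λ i → proj₂ (B⊆G i))) (lincomb-∘ c _ G))

  Span-tail : ∀ {m n} (u : Vec n) (B : Fam m n) → Span B ⊆ Span (u ∷ B)
  Span-tail u B = Span-mono B (u ∷ B) (λ i → Span-member (u ∷ B) (suc i))

  Span-single : ∀ {k} (w v : Vec k) → Span (w ∷ []) v → Σ Carrier (λ μ → v ≈ (μ · w))
  Span-single w v (c , p) = c zero , λ l → trans (p l) (+-identityʳ _)

module Decidability (𝔽 : FiniteField) where
  open FiniteField 𝔽
  open LinAlg 𝔽
  open Vectors 𝔽 public
  open Inverse enum using (to; from; strictlyInverseˡ)

  ∃-Carrier? : (P : Carrier → Set) → (∀ x → Dec (P x)) → Dec (Σ Carrier P)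
  ∃-Carrier? P P? = map′ (λ (i , p) → to i , p) (λ (x , p) → from x , subst P (sym (strictlyInverseˡ x)) p)
                         (FinP.any? (λ i → P? (to i)))

  ∀-Carrier? : (P : Carrier → Set) → (∀ x → Dec (P x)) → Dec (∀ x → P x)
  ∀-Carrier? P P? = map′ (λ all x → subst P (strictlyInverseˡ x) (all (from x))) (λ all i → all (to i))
                         (FinP.all? (λ i → P? (to i)))

  opaque
    ∃-Vec? : ∀ d (P : Pred d) → Resp P → (∀ v → Dec (P v)) → Dec (Σ (Vec d) P)
    ∃-Vec? zero P resp P? = map′ (λ p → _ , p) (λ (v , p) → resp (λ ()) p) (P? (λ ()))
    ∃-Vec? (suc d) P resp P? =
      map′ (λ (x , v , p) → x ∷ v , p)
           (λ (v , p) → v zero , (λ i → v (suc i)) , resp (λ { zero → refl ; (suc i) → refl }) p)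
           (∃-Carrier? (λ x → Σ (Vec d) (λ v → P (x ∷ v)))
                       (λ x → ∃-Vec? d (λ v → P (x ∷ v))
                                     (λ u≈v → resp (λ { zero → refl ; (suc i) → u≈v i }))
                                     (λ v → P? (x ∷ v))))

  _≈?_ : ∀ {n} (u v : Vec n) → Dec (u ≈ v)
  u ≈? v = FinP.all? (λ i → u i ≟ v i)

  opaque
    Span? : ∀ {m n} (B : Fam m n) v → Dec (Span B v)
    Span? {m} B v = ∃-Vec? m (λ c → v ≈ lincomb c B)
                           (λ c≈c' p → ≈-trans p (lincomb-congˡ B c≈c'))
                           (λ c → v ≈? lincomb c B)

module Dimension (𝔽 : FiniteField) where
  open FiniteField 𝔽
  open LinAlg 𝔽
  open Decidability 𝔽 public
  open ≡-Reasoning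

  tails : ∀ {m d} → Fam m (suc d) → Fam m d
  tails A i l = A i (suc l)

  tails-indep : ∀ {m d} (A : Fam m (suc d)) → LinIndep A → (∀ i → A i zero ≡ 0#) → LinIndep (tails A)
  tails-indep {m} A indep heads≡0 c h = indep c λ
    { zero    → sumF-zero {m} (λ i → trans (cong (c i *_) (heads≡0 i)) (zeroʳ (c i)))
    ; (suc l) → h l }

  -- One step of Gaussian elimination: the pivot row i₀ clears the first column.
  module Pivot {m d} (A : Fam (suc m) (suc d)) (i₀ : Fin (suc m)) (a≢0 : ¬ (A i₀ zero ≡ 0#)) where
    ratio : Vec m
    ratio j = A (punchIn i₀ j) zero * inv (A i₀ zero) a≢0

    reduced : Fam m (suc d)
    reduced j l = A (punchIn i₀ j) l + - (ratio j * A i₀ l)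

    reduced-head : ∀ j → reduced j zero ≡ 0#
    reduced-head j = trans (cong (λ t → A (punchIn i₀ j) zero + - t) cancel) (-‿inverseʳ _)
      where
      cancel : ratio j * A i₀ zero ≡ A (punchIn i₀ j) zero
      cancel = trans (*-assoc _ _ _) (trans (cong (A (punchIn i₀ j) zero *_) (inv-inverseˡ _ a≢0)) (*-identityʳ _))

    lincomb-reduced : ∀ c → lincomb c reduced ≈ lincomb (insertAt c i₀ (- dot c ratio)) A
    lincomb-reduced c l = begin
      sumF (λ j → c j * (A (p j) l + - (ratio j * A i₀ l)))
        ≡⟨ sumF-cong {m} (λ j → trans (distribˡ (c j) _ _)
                         (cong (c j * A (p j) l +_) (trans (sym (-‿distribʳ-* (c j) _)) (cong -_ (sym (*-assoc _ _ _)))))) ⟩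
      sumF (λ j → c j * A (p j) l + - ((c j * ratio j) * A i₀ l))
        ≡⟨ sumF-+ (λ j → c j * A (p j) l) (λ j → - ((c j * ratio j) * A i₀ l)) ⟩
      sumF (λ j → c j * A (p j) l) + sumF (λ j → - ((c j * ratio j) * A i₀ l))
        ≡⟨ cong (sumF (λ j → c j * A (p j) l) +_) (begin
             sumF (λ j → - ((c j * ratio j) * A i₀ l))  ≡⟨ sym (-‿distrib-sumF (λ j → (c j * ratio j) * A i₀ l)) ⟩
             - sumF (λ j → (c j * ratio j) * A i₀ l)    ≡⟨ cong -_ (sym (*-distribʳ-sumF (A i₀ l) (λ j → c j * ratio j))) ⟩
             - (dot c ratio * A i₀ l)                   ≡⟨ -‿distribˡ-* _ _ ⟩
             - dot c ratio * A i₀ l                     ∎) ⟩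
      sumF (λ j → c j * A (p j) l) + - dot c ratio * A i₀ l
        ≡⟨ +-comm _ _ ⟩
      - dot c ratio * A i₀ l + sumF (λ j → c j * A (p j) l)
        ≡⟨ sym (cong₂ _+_ (cong (_* A i₀ l) (insertAt-lookup c i₀ _))
                          (sumF-cong {m} (λ j → cong (_* A (p j) l) (insertAt-punchIn c i₀ _ j)))) ⟩
      c' i₀ * A i₀ l + sumF (λ j → c' (p j) * A (p j) l)
        ≡⟨ sym (sumF-punchIn i₀ (λ i → c' i * A i l)) ⟩
      lincomb c' A l ∎
      where
      p = punchIn i₀
      c' = insertAt c i₀ (- dot c ratio)

    reduced-indep : LinIndep A → LinIndep reduced
    reduced-indep indep c h j = begin
      c j                                      ≡⟨ sym (insertAt-punchIn c i₀ _ j) ⟩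
      insertAt c i₀ (- dot c ratio) (punchIn i₀ j)
        ≡⟨ indep (insertAt c i₀ (- dot c ratio)) (≈-trans (≈-sym (lincomb-reduced c)) h) (punchIn i₀ j) ⟩
      0#                                       ∎

  LinIndep⇒≤ : ∀ {m d} (A : Fam m d) → LinIndep A → m ≤ d
  LinIndep⇒≤ {zero}        A indep = z≤n
  LinIndep⇒≤ {suc _} {zero} A indep = ⊥-elim (1≢0 (indep (e zero) (λ ()) zero))
  LinIndep⇒≤ {suc m} {suc d} A indep with FinP.all? (λ i → A i zero ≟ 0#)
  ... | yes heads≡0 = ℕP.m≤n⇒m≤1+n (LinIndep⇒≤ (tails A) (tails-indep A indep heads≡0))
  ... | no ¬heads≡0 =
    let (i₀ , a≢0) = FinP.¬∀⟶∃¬ _ _ (λ i → A i zero ≟ 0#) ¬heads≡0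
        open Pivot A i₀ a≢0
    in s≤s (LinIndep⇒≤ (tails reduced) (tails-indep reduced (reduced-indep indep) reduced-head))

  LinIndep-∷ : ∀ {m n} (B : Fam m n) v → LinIndep B → ¬ Span B v → LinIndep (v ∷ B)
  LinIndep-∷ {m} B v indep v∉B c h = coeffs≡0
    where
    c' : Vec m
    c' i = c (suc i)
    head≡0 : c zero ≡ 0#
    head≡0 with c zero ≟ 0#
    ... | yes c₀≡0 = c₀≡0
    ... | no c₀≢0 = ⊥-elim (v∉B ((λ i → - (c⁻¹ * c' i)) , v≈))
      where
      c⁻¹ = inv (c zero) c₀≢0
      v≈ : v ≈ lincomb (λ i → - (c⁻¹ * c' i)) B
      v≈ j = begin
        v j                              ≡⟨ sym (inv-cancelˡ (c zero) c₀≢0 (v j)) ⟩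
        c⁻¹ * (c zero * v j)             ≡⟨ cong (c⁻¹ *_) (+-inverseʳ-unique (lincomb c' B j) _ (trans (+-comm _ _) (h j))) ⟩
        c⁻¹ * (- lincomb c' B j)         ≡⟨ sym (-‿distribʳ-* c⁻¹ _) ⟩
        - (c⁻¹ * lincomb c' B j)         ≡⟨ cong -_ (sym (lincomb-· c⁻¹ c' B j)) ⟩
        - lincomb (c⁻¹ · c') B j         ≡⟨ sym (lincomb-neg (c⁻¹ · c') B j) ⟩
        lincomb (λ i → - (c⁻¹ * c' i)) B j ∎
    tail≡0 : lincomb c' B ≈ 0v
    tail≡0 j = begin
      lincomb c' B j                   ≡⟨ sym (+-identityˡ _) ⟩
      0# + lincomb c' B j              ≡⟨ cong (_+ lincomb c' B j) (sym (trans (cong (_* v j) head≡0) (zeroˡ (v j)))) ⟩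
      c zero * v j + lincomb c' B j    ≡⟨ h j ⟩
      0#                               ∎
    coeffs≡0 : ∀ i → c i ≡ 0#
    coeffs≡0 zero    = head≡0
    coeffs≡0 (suc i) = indep c' tail≡0 i

  LinIndep-∷⇒∉ : ∀ {m n} (B : Fam m n) v → LinIndep (v ∷ B) → ¬ Span B v
  LinIndep-∷⇒∉ {m} B v indep (c , p) = 1≢0 (indep d d≡0 zero)
    where
    d : Vec (suc m)
    d = 1# ∷ (λ i → - c i)
    d≡0 : lincomb d (v ∷ B) ≈ 0v
    d≡0 j = trans (cong₂ _+_ (trans (*-identityˡ (v j)) (p j)) (lincomb-neg c B j)) (-‿inverseʳ _)

  LinIndep⇒≢0 : ∀ {d k} (Z : Fam d k) → LinIndep Z → ∀ j → ¬ (Z j ≈ 0v)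
  LinIndep⇒≢0 Z indep j Zj≈0 = 1≢0 (trans (sym (e-diag j)) (indep (e j) (λ l → trans (lincomb-e j Z l) (Zj≈0 l)) j))

  LinIndep-single : ∀ {k} (w : Vec k) → ¬ (w ≈ 0v) → LinIndep (w ∷ [])
  LinIndep-single w w≢0 c h zero with c zero ≟ 0#
  ... | yes c₀≡0 = c₀≡0
  ... | no c₀≢0 = ⊥-elim (w≢0 (λ l → *-zero-nonzeroˡ (c zero) c₀≢0 (trans (sym (+-identityʳ _)) (h l))))

  e-indep : ∀ {n} → LinIndep (e {n})
  e-indep c h i = trans (sym (sumF-eʳ i c)) (h i)

  e-spans : ∀ {n} (v : Vec n) → Span e v
  e-spans v = v , λ j → sym (sumF-eʳ j v)

  steinitz : ∀ {m d n} (B : Fam m n) → LinIndep B → (G : Fam d n) → (∀ i → Span G (B i)) → m ≤ d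
  steinitz B indep G B⊆G = LinIndep⇒≤ coords coords-indep
    where
    coords = λ i → proj₁ (B⊆G i)
    coords-indep : LinIndep coords
    coords-indep c h = indep c (λ j → begin
      lincomb c B j                            ≡⟨ lincomb-cong ≈-refl (λ i → proj₂ (B⊆G i)) j ⟩
      lincomb c (λ i → lincomb (coords i) G) j ≡⟨ lincomb-∘ c coords G j ⟩
      lincomb (lincomb c coords) G j           ≡⟨ lincomb-congˡ G h j ⟩
      lincomb 0v G j                           ≡⟨ lincomb-zero G j ⟩
      0#                                       ∎)

  module _ {n} {P : Pred n} {d} (P-dim : HasDim P d) where
    basis : Fam d n
    basis = proj₁ P-dim

    basis-indep : LinIndep basis
    basis-indep = proj₁ (proj₂ P-dim)

    toSpan : ∀ v → P v → Span basis v
    toSpan v = proj₁ (proj₂ (proj₂ P-dim) v)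

    fromSpan : ∀ v → Span basis v → P v
    fromSpan v = proj₂ (proj₂ (proj₂ P-dim) v)

    HasDim-dec : ∀ v → Dec (P v)
    HasDim-dec v = map′ (fromSpan v) (toSpan v) (Span? basis v)

    Span⊆HasDim : ∀ {m} (F : Fam m n) → (∀ i → P (F i)) → Span F ⊆ P
    Span⊆HasDim F F⊆P v s = fromSpan v (Span-mono F basis (λ i → toSpan (F i) (F⊆P i)) v s)

    basis-member : ∀ i → P (basis i)
    basis-member i = fromSpan _ (Span-member basis i)

  HasDim-⇔ : ∀ {n} {P Q : Pred n} {d} → HasDim P d → (∀ v → P v ⇔ Q v) → HasDim Q d
  HasDim-⇔ (B , indep , P⇔B) P⇔Q = B , indep , λ v → (λ q → proj₁ (P⇔B v) (proj₂ (P⇔Q v) q))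
                                                  , (λ s → proj₁ (P⇔Q v) (proj₂ (P⇔B v) s))

  Span-HasDim : ∀ {m n} (B : Fam m n) → LinIndep B → HasDim (Span B) m
  Span-HasDim B indep = B , indep , λ v → (λ s → s) , (λ s → s)

  dim-unique : ∀ {n} {P : Pred n} {d d'} → HasDim P d → HasDim P d' → d ≡ d'
  dim-unique hd hd' = ℕP.≤-antisym
    (steinitz (basis hd) (basis-indep hd) (basis hd') (λ i → toSpan hd' _ (basis-member hd i)))
    (steinitz (basis hd') (basis-indep hd') (basis hd) (λ i → toSpan hd _ (basis-member hd' i)))

  ⊆-sameDim⇒⊇ : ∀ {n} {P Q : Pred n} {d} → HasDim P d → HasDim Q d → Q ⊆ P → P ⊆ Q
  ⊆-sameDim⇒⊇ P-dim Q-dim Q⊆P v Pv with HasDim-dec Q-dim v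
  ... | yes Qv = Qv
  ... | no ¬Qv = ⊥-elim (ℕP.<-irrefl refl (steinitz (v ∷ basis Q-dim) extended-indep (basis P-dim) inP))
    where
    extended-indep = LinIndep-∷ (basis Q-dim) v (basis-indep Q-dim) (λ s → ¬Qv (fromSpan Q-dim v s))
    inP : ∀ i → Span (basis P-dim) ((v ∷ basis Q-dim) i)
    inP zero    = toSpan P-dim v Pv
    inP (suc i) = toSpan P-dim _ (Q⊆P _ (basis-member Q-dim i))

  opaque
    ∃-outside-Span : ∀ {n} {P : Pred n} {d d'} → HasDim P d → (B : Fam d' n) → d' < d →
                     Σ (Vec n) (λ v → P v × ¬ Span B v)
    ∃-outside-Span P-dim B d'<d with FinP.all? (λ i → Span? B (basis P-dim i))
    ... | yes inB = ⊥-elim (ℕP.<⇒≱ d'<d (steinitz (basis P-dim) (basis-indep P-dim) B inB))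
    ... | no ¬inB = let (i , i∉B) = FinP.¬∀⟶∃¬ _ _ (λ i → Span? B (basis P-dim i)) ¬inB
                    in basis P-dim i , basis-member P-dim i , i∉B

  exchange : ∀ {m n} (B : Fam m n) u v → Span (u ∷ B) v → ¬ Span B v → Span (v ∷ B) u
  exchange B u v (c , p) v∉B with c zero ≟ 0#
  ... | yes c₀≡0 = ⊥-elim (v∉B ((λ i → c (suc i)) , λ j → trans (p j)
          (trans (cong (_+ lincomb (λ i → c (suc i)) B j) (trans (cong (_* u j) c₀≡0) (zeroˡ _))) (+-identityˡ _))))
  ... | no c₀≢0 = (c⁻¹ ∷ λ i → - (c⁻¹ * c' i)) , u≈
    where
    c⁻¹ = inv (c zero) c₀≢0
    c' = λ i → c (suc i)
    rest = λ j → lincomb c' B j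
    u≈ : u ≈ lincomb (c⁻¹ ∷ λ i → - (c⁻¹ * c' i)) (v ∷ B)
    u≈ j = begin
      u j                                        ≡⟨ sym (inv-cancelˡ (c zero) c₀≢0 (u j)) ⟩
      c⁻¹ * (c zero * u j)                       ≡⟨ cong (c⁻¹ *_) (sym (+-neg-cancelʳ _ (rest j))) ⟩
      c⁻¹ * ((c zero * u j + rest j) + - rest j) ≡⟨ cong (λ z → c⁻¹ * (z + - rest j)) (sym (p j)) ⟩
      c⁻¹ * (v j + - rest j)                     ≡⟨ distribˡ c⁻¹ _ _ ⟩
      c⁻¹ * v j + c⁻¹ * - rest j                 ≡⟨ cong (c⁻¹ * v j +_) (sym (-‿distribʳ-* c⁻¹ _)) ⟩
      c⁻¹ * v j + - (c⁻¹ * rest j)               ≡⟨ cong (λ z → c⁻¹ * v j + - z) (sym (lincomb-· c⁻¹ c' B j)) ⟩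
      c⁻¹ * v j + - lincomb (c⁻¹ · c') B j       ≡⟨ cong (c⁻¹ * v j +_) (sym (lincomb-neg (c⁻¹ · c') B j)) ⟩
      c⁻¹ * v j + lincomb (λ i → - (c⁻¹ * c' i)) B j ∎

  LinIndep-tail : ∀ {m n} (G : Fam (suc m) n) → LinIndep G → LinIndep (λ i → G (suc i))
  LinIndep-tail G indep c h i = indep (0# ∷ c) 0∷c≈0 (suc i)
    where
    0∷c≈0 : lincomb (0# ∷ c) G ≈ 0v
    0∷c≈0 j = trans (cong (_+ lincomb c (λ i → G (suc i)) j) (zeroˡ _)) (trans (+-identityˡ _) (h j))

  record Extension {t r n} (B : Fam t n) (F : Fam r n) : Set where
    field
      s     : ℕ
      G     : Fam (s ℕ.+ t) n
      indep : LinIndep G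
      keeps : ∀ i → G (s ↑ʳ i) ≡ B i
      spans : ∀ k → Span G (F k)

  opaque
    extend : ∀ {t r n} (B : Fam t n) → LinIndep B → (F : Fam r n) → Extension B F
    extend {n = n} B indep = go
      where
      go : ∀ {r} (F : Fam r n) → Extension B F
      go {zero} F = record { s = 0 ; G = B ; indep = indep ; keeps = λ i → refl ; spans = λ () }
      go {suc r} F with go (λ k → F (suc k))
      ... | E with Span? (Extension.G E) (F zero)
      ... | yes F₀∈G = record { Extension E ; spans = λ { zero → F₀∈G ; (suc k) → Extension.spans E k } }
      ... | no F₀∉G = record
        { s = suc (Extension.s E)
        ; G = F zero ∷ Extension.G E
        ; indep = LinIndep-∷ (Extension.G E) (F zero) (Extension.indep E) F₀∉G
        ; keeps = Extension.keeps E
        ; spans = λ { zero → Span-member (F zero ∷ Extension.G E) zero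
                    ; (suc k) → Span-tail (F zero) (Extension.G E) (F (suc k)) (Extension.spans E k) } }

  lincomb-injective : ∀ {m n} (G : Fam m n) → LinIndep G → ∀ c c' → lincomb c G ≈ lincomb c' G → c ≈ c'
  lincomb-injective G indep c c' h i = x∙y⁻¹≈ε⇒x≈y (c i) (c' i) (indep (λ i → c i + - c' i) diff≈0 i)
    where
    diff≈0 : lincomb (λ i → c i + - c' i) G ≈ 0v
    diff≈0 j = trans (lincomb-+ c (λ i → - c' i) G j) (trans (cong₂ _+_ (h j) (lincomb-neg c' G j)) (-‿inverseʳ _))

  ⊈⇒∃ : ∀ {n} {P Q : Pred n} {d d'} → HasDim P d → HasDim Q d' → ¬ (P ⊆ Q) → Σ (Vec n) (λ v → P v × ¬ Q v)
  ⊈⇒∃ P-dim Q-dim P⊈Q with FinP.all? (λ i → HasDim-dec Q-dim (basis P-dim i))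
  ... | yes basis⊆Q = ⊥-elim (P⊈Q (λ v Pv → Span⊆HasDim Q-dim (basis P-dim) basis⊆Q v (toSpan P-dim v Pv)))
  ... | no basis⊈Q = let (i , i∉Q) = FinP.¬∀⟶∃¬ _ _ (λ i → HasDim-dec Q-dim (basis P-dim i)) basis⊈Q
                     in basis P-dim i , basis-member P-dim i , i∉Q

  sandwich : ∀ {n} {P Q R : Pred n} {d} → HasDim P d → HasDim R d → R ⊆ P → R ⊆ Q → P ⊆ Q
  sandwich P-dim R-dim R⊆P R⊆Q v Pv = R⊆Q v (⊆-sameDim⇒⊇ P-dim R-dim R⊆P v Pv)

module Duality (𝔽 : FiniteField) where
  open FiniteField 𝔽
  open LinAlg 𝔽
  open Dimension 𝔽 public
  open ≡-Reasoning

  Perp : ∀ {t n} → Fam t n → Pred n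
  Perp B x = ∀ i → dot (B i) x ≡ 0#

  Perp-lincomb : ∀ {t m n} (B : Fam t n) (Z : Fam m n) → (∀ j → Perp B (Z j)) → ∀ c → Perp B (lincomb c Z)
  Perp-lincomb B Z Z⊥B c i =
    trans (dot-lincombʳ (B i) c Z) (sumF-zero (λ j → trans (cong (c j *_) (Z⊥B j i)) (zeroʳ (c j))))

  lincomb-split : ∀ s {t n} (a : Vec (s ℕ.+ t)) (G : Fam (s ℕ.+ t) n) →
                  lincomb a G ≈ (lincomb (λ j → a (j ↑ˡ t)) (λ j → G (j ↑ˡ t))
                                 ⊕ lincomb (λ i → a (s ↑ʳ i)) (λ i → G (s ↑ʳ i)))
  lincomb-split s a G l = sumF-split s (λ j → a j * G j l)

  e-↑ˡ : ∀ {s} t (j k : Fin s) → e (j ↑ˡ t) (k ↑ˡ t) ≡ e j k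
  e-↑ˡ t zero    zero    = refl
  e-↑ˡ t zero    (suc k) = refl
  e-↑ˡ t (suc j) zero    = refl
  e-↑ˡ t (suc j) (suc k) = e-↑ˡ t j k

  e-↑ʳ↑ˡ : ∀ s {t} (i : Fin t) (j : Fin s) → e (s ↑ʳ i) (j ↑ˡ t) ≡ 0#
  e-↑ʳ↑ˡ (suc s) i zero    = refl
  e-↑ʳ↑ˡ (suc s) i (suc j) = e-↑ʳ↑ˡ s i j

  dot-determines : ∀ {N n} (G : Fam N n) → (∀ v → Span G v) → ∀ x y → (∀ i → dot (G i) x ≡ dot (G i) y) → x ≈ y
  dot-determines G G-spans x y same l = begin
    x l                             ≡⟨ sym (sumF-eˡ l x) ⟩
    dot (e l) x                     ≡⟨ dot-congˡ x (proj₂ (G-spans (e l))) ⟩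
    dot (lincomb a G) x             ≡⟨ dot-lincombˡ x a G ⟩
    sumF (λ i → a i * dot (G i) x)  ≡⟨ sumF-cong (λ i → cong (a i *_) (same i)) ⟩
    sumF (λ i → a i * dot (G i) y)  ≡⟨ sym (dot-lincombˡ y a G) ⟩
    dot (lincomb a G) y             ≡⟨ sym (dot-congˡ y (proj₂ (G-spans (e l)))) ⟩
    dot (e l) y                     ≡⟨ sumF-eˡ l y ⟩
    y l                             ∎
    where a = proj₁ (G-spans (e l))

  -- B is completed to a basis G = H ++ B of F^n with dual basis D; the part Z of D dual to H is
  -- a basis of B^⊥, and coord gives the H-coordinates of a vector.
  module Complement {t n} (B : Fam t n) (B-indep : LinIndep B) where
    private
      E : Extension B e
      E = extend B B-indep e
      module E = Extension E

    s : ℕ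
    s = E.s

    G : Fam (s ℕ.+ t) n
    G = E.G

    G-spans : ∀ v → Span G v
    G-spans v = Span-mono e G E.spans v (e-spans v)

    size : s ℕ.+ t ≡ n
    size = ℕP.≤-antisym (steinitz G E.indep e (λ _ → e-spans _)) (steinitz e e-indep G E.spans)

    D : Fam (s ℕ.+ t) n
    D j l = proj₁ (G-spans (e l)) j

    dual : ∀ i j → dot (G i) (D j) ≡ e i j
    dual i = lincomb-injective G E.indep (λ j → dot (G i) (D j)) (e i) G-expansion
      where
      coeff = λ l → proj₁ (G-spans (e l))
      G-expansion : lincomb (λ j → dot (G i) (D j)) G ≈ lincomb (e i) G
      G-expansion x = begin
        sumF (λ j → sumF (λ l → G i l * coeff l j) * G j x)
          ≡⟨ sumF-cong (λ j → *-distribʳ-sumF (G j x) (λ l → G i l * coeff l j)) ⟩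
        sumF (λ j → sumF (λ l → (G i l * coeff l j) * G j x))
          ≡⟨ sumF-comm (λ j l → (G i l * coeff l j) * G j x) ⟩
        sumF (λ l → sumF (λ j → (G i l * coeff l j) * G j x))
          ≡⟨ sumF-cong (λ l → sumF-cong (λ j → *-assoc (G i l) (coeff l j) (G j x))) ⟩
        sumF (λ l → sumF (λ j → G i l * (coeff l j * G j x)))
          ≡⟨ sumF-cong (λ l → sym (*-distribˡ-sumF (G i l) (λ j → coeff l j * G j x))) ⟩
        sumF (λ l → G i l * lincomb (coeff l) G x)
          ≡⟨ sumF-cong (λ l → cong (G i l *_) (sym (proj₂ (G-spans (e l)) x))) ⟩
        sumF (λ l → G i l * e l x)
          ≡⟨ sumF-eʳ x (G i) ⟩
        G i x
          ≡⟨ sym (lincomb-e i G x) ⟩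
        lincomb (e i) G x ∎

    dot-lincomb-D : ∀ c i → dot (G i) (lincomb c D) ≡ c i
    dot-lincomb-D c i = begin
      dot (G i) (lincomb c D)             ≡⟨ dot-lincombʳ (G i) c D ⟩
      sumF (λ j → c j * dot (G i) (D j))  ≡⟨ sumF-cong (λ j → cong (c j *_) (trans (dual i j) (e-sym i j))) ⟩
      sumF (λ j → c j * e j i)            ≡⟨ sumF-eʳ i c ⟩
      c i                                 ∎

    dot-lincomb-G : ∀ c j → dot (lincomb c G) (D j) ≡ c j
    dot-lincomb-G c j = begin
      dot (lincomb c G) (D j)             ≡⟨ dot-lincombˡ (D j) c G ⟩
      sumF (λ i → c i * dot (G i) (D j))  ≡⟨ sumF-cong (λ i → cong (c i *_) (dual i j)) ⟩
      sumF (λ i → c i * e i j)            ≡⟨ sumF-eʳ j c ⟩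
      c j                                 ∎

    G-coordinates : ∀ v → v ≈ lincomb (λ j → dot v (D j)) G
    G-coordinates v = ≈-trans (proj₂ (G-spans v))
      (lincomb-congˡ G (λ j → sym (trans (dot-congˡ (D j) (proj₂ (G-spans v))) (dot-lincomb-G _ j))))

    D-coordinates : ∀ x → x ≈ lincomb (λ j → dot (G j) x) D
    D-coordinates x = dot-determines G G-spans x _ (λ i → sym (dot-lincomb-D (λ j → dot (G j) x) i))

    keeps : ∀ i → G (s ↑ʳ i) ≈ B i
    keeps i l = cong (λ v → v l) (E.keeps i)

    H : Fam s n
    H j = G (j ↑ˡ t)

    Z : Fam s n
    Z j = D (j ↑ˡ t)

    coord : Vec n → Vec s
    coord v j = dot v (Z j)

    coordᴮ : Vec n → Vec t
    coordᴮ v i = dot v (D (s ↑ʳ i))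

    decompose : ∀ v → v ≈ (lincomb (coord v) H ⊕ lincomb (coordᴮ v) B)
    decompose v l = trans (G-coordinates v l)
      (trans (lincomb-split s _ G l) (cong (lincomb (coord v) H l +_) (lincomb-cong ≈-refl keeps l)))

    Z⊥B : ∀ j → Perp B (Z j)
    Z⊥B j i = trans (dot-congˡ (Z j) (≈-sym (keeps i))) (trans (dual _ _) (e-↑ʳ↑ˡ s i j))

    Span-Z⇒Perp : ∀ x → Span Z x → Perp B x
    Span-Z⇒Perp x (c , x≈) i = trans (dot-congʳ (B i) x≈) (Perp-lincomb B Z Z⊥B c i)

    Perp⇒Span-Z : ∀ x → Perp B x → Span Z x
    Perp⇒Span-Z x x⊥B = (λ j → a (j ↑ˡ t)) , λ l → begin
      x l                                                           ≡⟨ D-coordinates x l ⟩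
      lincomb a D l                                                 ≡⟨ lincomb-split s a D l ⟩
      lincomb (λ j → a (j ↑ˡ t)) Z l + lincomb (λ i → a (s ↑ʳ i)) D-B l
        ≡⟨ cong (lincomb (λ j → a (j ↑ˡ t)) Z l +_) (trans (lincomb-congˡ D-B a-B≡0 l) (lincomb-zero D-B l)) ⟩
      lincomb (λ j → a (j ↑ˡ t)) Z l + 0#                           ≡⟨ +-identityʳ _ ⟩
      lincomb (λ j → a (j ↑ˡ t)) Z l                                ∎
      where
      a = λ j → dot (G j) x
      D-B = λ i → D (s ↑ʳ i)
      a-B≡0 : ∀ i → a (s ↑ʳ i) ≡ 0#
      a-B≡0 i = trans (dot-congˡ x (keeps i)) (x⊥B i)

    H-dot-Z : ∀ l j → dot (H l) (Z j) ≡ e l j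
    H-dot-Z l j = trans (dual _ _) (e-↑ˡ t l j)

    Z-indep : LinIndep Z
    Z-indep c h j = begin
      c j                                 ≡⟨ sym (sumF-eʳ j c) ⟩
      sumF (λ k → c k * e k j)            ≡⟨ sumF-cong (λ k → cong (c k *_) (sym (trans (H-dot-Z j k) (e-sym j k)))) ⟩
      sumF (λ k → c k * dot (H j) (Z k))  ≡⟨ sym (dot-lincombʳ (H j) c Z) ⟩
      dot (H j) (lincomb c Z)             ≡⟨ dot-congʳ (H j) h ⟩
      dot (H j) 0v                        ≡⟨ dot-zeroʳ (H j) ⟩
      0#                                  ∎

    coord-H : ∀ z → coord (lincomb z H) ≈ z
    coord-H z j = trans (dot-lincombˡ _ z H) (trans (sumF-cong (λ l → cong (z l *_) (H-dot-Z l j))) (sumF-eʳ j z))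

    coord-B : ∀ c → coord (lincomb c B) ≈ 0v
    coord-B c j = trans (dot-lincombˡ (Z j) c B) (sumF-zero (λ i → trans (cong (c i *_) (Z⊥B j i)) (zeroʳ (c i))))

    Span-B⇒coord≈0 : ∀ v → Span B v → coord v ≈ 0v
    Span-B⇒coord≈0 v (c , v≈) = ≈-trans (λ j → dot-congˡ (Z j) v≈) (coord-B c)

    coord≈0⇒Span-B : ∀ v → coord v ≈ 0v → Span B v
    coord≈0⇒Span-B v coord≈0 = coordᴮ v , λ l → begin
      v l                                                    ≡⟨ decompose v l ⟩
      lincomb (coord v) H l + lincomb (coordᴮ v) B l
        ≡⟨ cong (_+ lincomb (coordᴮ v) B l) (trans (lincomb-congˡ H coord≈0 l) (lincomb-zero H l)) ⟩
      0# + lincomb (coordᴮ v) B l                            ≡⟨ +-identityˡ _ ⟩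
      lincomb (coordᴮ v) B l                                 ∎

    coord-∷ : ∀ h (d : Vec (suc t)) → coord (lincomb d (h ∷ B)) ≈ (d zero · coord h)
    coord-∷ h d j = begin
      dot (lincomb d (h ∷ B)) (Z j)                                ≡⟨ dot-lincombˡ (Z j) d (h ∷ B) ⟩
      d zero * coord h j + sumF (λ i → d (suc i) * dot (B i) (Z j))
        ≡⟨ cong (d zero * coord h j +_) (sumF-zero (λ i → trans (cong (d (suc i) *_) (Z⊥B j i)) (zeroʳ _))) ⟩
      d zero * coord h j + 0#                                          ≡⟨ +-identityʳ _ ⟩
      d zero * coord h j                                               ∎

    complement-part : ∀ v → Span (v ∷ B) (lincomb (coord v) H)
    complement-part v = (1# ∷ λ i → - coordᴮ v i) , λ l → sym (begin
      1# * v l + lincomb (λ i → - coordᴮ v i) B l          ≡⟨ cong₂ _+_ (*-identityˡ (v l)) (lincomb-neg (coordᴮ v) B l) ⟩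
      v l + - lincomb (coordᴮ v) B l                       ≡⟨ cong (_+ - lincomb (coordᴮ v) B l) (decompose v l) ⟩
      (lincomb (coord v) H l + lincomb (coordᴮ v) B l) + - lincomb (coordᴮ v) B l ≡⟨ +-neg-cancelʳ _ _ ⟩
      lincomb (coord v) H l                                ∎)

    double-perp : ∀ y → (∀ x → Perp B x → dot y x ≡ 0#) → Span B y
    double-perp y y⊥ = coord≈0⇒Span-B y (λ j → y⊥ (Z j) (Z⊥B j))

  Perp-HasDim : ∀ {t s m} (B : Fam t m) → LinIndep B → s ℕ.+ t ≡ m → HasDim (Perp B) s
  Perp-HasDim {t} B B-indep s+t≡m =
    subst (HasDim (Perp B)) (ℕP.+-cancelʳ-≡ t _ _ (trans size (sym s+t≡m)))
          (Z , Z-indep , λ x → Perp⇒Span-Z x , Span-Z⇒Perp x)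
    where open Complement B B-indep

  Im : ∀ {k n} → Fam k n → Pred k → Pred n
  Im G T v = Σ (Vec _) (λ c → T c × v ≈ lincomb c G)

  Im-HasDim : ∀ {k n d} (G : Fam k n) → LinIndep G → (T : Pred k) → HasDim T d → HasDim (Im G T) d
  Im-HasDim {n = n} {d} G G-indep T T-dim = W , W-indep , λ v → to v , from v
    where
    W : Fam d n
    W j = lincomb (basis T-dim j) G
    W-lincomb : ∀ μ → lincomb μ W ≈ lincomb (lincomb μ (basis T-dim)) G
    W-lincomb μ = lincomb-∘ μ (basis T-dim) G
    W-indep : LinIndep W
    W-indep μ h = basis-indep T-dim μ (G-indep (lincomb μ (basis T-dim)) (≈-trans (≈-sym (W-lincomb μ)) h))
    to : ∀ v → Im G T v → Span W v
    to v (c , Tc , v≈) = let (μ , c≈) = toSpan T-dim c Tc in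
      μ , ≈-trans v≈ (≈-trans (lincomb-congˡ G c≈) (≈-sym (W-lincomb μ)))
    from : ∀ v → Span W v → Im G T v
    from v (μ , v≈) = lincomb μ (basis T-dim) , fromSpan T-dim _ (Span-lincomb (basis T-dim) μ) , ≈-trans v≈ (W-lincomb μ)

  Hyp : ∀ {k n} → Fam k n → Vec k → Pred n
  Hyp G w = Im G (λ c → dot c w ≡ 0#)

  Hyp-HasDim : ∀ {k n} (G : Fam (suc k) n) → LinIndep G → (w : Vec (suc k)) → ¬ (w ≈ 0v) → HasDim (Hyp G w) k
  Hyp-HasDim G G-indep w w≢0 = Im-HasDim G G-indep _
    (HasDim-⇔ (Perp-HasDim (w ∷ []) (LinIndep-single w w≢0) (ℕP.+-comm _ 1))
              (λ c → (λ c⊥w → trans (dot-comm c w) (c⊥w zero)) , (λ { c⊥w zero → trans (dot-comm w c) c⊥w })))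

  Perp-single⇒proportional : ∀ {m} (y : Vec m) → ¬ (y ≈ 0v) → ∀ g → (∀ x → dot x y ≡ 0# → dot x g ≡ 0#) →
                             Σ Carrier (λ μ → g ≈ (μ · y))
  Perp-single⇒proportional y y≢0 g y⊥⊆g⊥ =
    Span-single y g (Complement.double-perp (y ∷ []) (LinIndep-single y y≢0) g
      (λ x x⊥y → trans (dot-comm g x) (y⊥⊆g⊥ x (trans (dot-comm x y) (x⊥y zero)))))

  hyperplane-normal : ∀ {k} (t : Fam k (suc k)) → LinIndep t →
    Σ (Vec (suc k)) (λ w → ¬ (w ≈ 0v) × (∀ c → (Span t c → dot c w ≡ 0#) × (dot c w ≡ 0# → Span t c)))
  hyperplane-normal {k} t t-indep = normal (ℕP.+-cancelʳ-≡ k _ 1 size) Z Z-indep Z⊥B Perp⇒Span-Z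
    where
    open Complement t t-indep
    normal : ∀ {s} → s ≡ 1 → (Z : Fam s (suc k)) → LinIndep Z → (∀ j → Perp t (Z j)) → (∀ x → Perp t x → Span Z x) →
             Σ (Vec (suc k)) (λ w → ¬ (w ≈ 0v) × (∀ c → (Span t c → dot c w ≡ 0#) × (dot c w ≡ 0# → Span t c)))
    normal refl Z Z-indep Z⊥t Perp⊆Z = w , LinIndep⇒≢0 Z Z-indep zero , λ c → to c , from c
      where
      w = Z zero
      to : ∀ c → Span t c → dot c w ≡ 0#
      to c (μ , c≈) = trans (dot-congˡ w c≈)
        (trans (dot-lincombˡ w μ t) (sumF-zero (λ j → trans (cong (μ j *_) (Z⊥t zero j)) (zeroʳ (μ j)))))
      from : ∀ c → dot c w ≡ 0# → Span t c
      from c c⊥w = double-perp c (λ x x⊥t →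
        let (μ , x≈) = Span-single w x (Perp⊆Z x x⊥t) in
        trans (dot-congʳ c x≈) (trans (dot-·ʳ c w μ) (trans (cong (μ *_) c⊥w) (zeroʳ μ))))

  dot-scale : ∀ {m} (c : Vec m) {w w' : Vec m} μ → ¬ (μ ≡ 0#) → w' ≈ (μ · w) → (dot c w' ≡ 0#) ⇔ (dot c w ≡ 0#)
  dot-scale c {w} μ μ≢0 w'≈ =
    (λ c⊥w' → *-zero-nonzeroˡ μ μ≢0 (trans (sym (dot-·ʳ c w μ)) (trans (dot-congʳ c (≈-sym w'≈)) c⊥w'))) ,
    (λ c⊥w → trans (dot-congʳ c w'≈) (trans (dot-·ʳ c w μ) (trans (cong (μ *_) c⊥w) (zeroʳ μ))))

  Hyp-scale : ∀ {k n} (G : Fam k n) {w w' : Vec k} μ → ¬ (μ ≡ 0#) → w' ≈ (μ · w) → ∀ v → Hyp G w' v ⇔ Hyp G w v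
  Hyp-scale G μ μ≢0 w'≈ v =
    (λ (c , c⊥ , v≈) → c , proj₁ (dot-scale c μ μ≢0 w'≈) c⊥ , v≈) ,
    (λ (c , c⊥ , v≈) → c , proj₂ (dot-scale c μ μ≢0 w'≈) c⊥ , v≈)

  codim1⇒Hyp : ∀ {k n} {S : Pred n} (G : Fam (suc k) n) → LinIndep G → HasDim S k → S ⊆ Span G →
               Σ (Vec (suc k)) (λ w → ¬ (w ≈ 0v) × (∀ v → S v ⇔ Hyp G w v))
  codim1⇒Hyp {S = S} G G-indep S-dim S⊆G = w , w≢0 , λ v → to v , from v
    where
    S-basis = basis S-dim
    t = λ j → proj₁ (S⊆G (S-basis j) (basis-member S-dim j))
    S-basis-lincomb : ∀ μ → lincomb μ S-basis ≈ lincomb (lincomb μ t) G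
    S-basis-lincomb μ = ≈-trans (lincomb-cong ≈-refl (λ j → proj₂ (S⊆G (S-basis j) (basis-member S-dim j)))) (lincomb-∘ μ t G)
    t-indep : LinIndep t
    t-indep μ h = basis-indep S-dim μ
      (≈-trans (S-basis-lincomb μ) (≈-trans (lincomb-congˡ G h) (lincomb-zero G)))
    normal = hyperplane-normal t t-indep
    w = proj₁ normal
    w≢0 = proj₁ (proj₂ normal)
    t⇔w = proj₂ (proj₂ normal)
    to : ∀ v → S v → Hyp G w v
    to v v∈S = let (μ , v≈) = toSpan S-dim v v∈S in
      lincomb μ t , proj₁ (t⇔w _) (Span-lincomb t μ) , ≈-trans v≈ (S-basis-lincomb μ)
    from : ∀ v → Hyp G w v → S v
    from v (c , c⊥w , v≈) = let (ν , c≈) = proj₂ (t⇔w c) c⊥w in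
      fromSpan S-dim v (ν , ≈-trans v≈ (≈-trans (lincomb-congˡ G c≈) (≈-sym (S-basis-lincomb ν))))

  Hyp⊆⇒proportional : ∀ {k n} (G : Fam k n) → LinIndep G → ∀ w w' → ¬ (w ≈ 0v) → Hyp G w ⊆ Hyp G w' →
                      Σ Carrier (λ μ → w' ≈ (μ · w))
  Hyp⊆⇒proportional G G-indep w w' w≢0 w⊆w' = Perp-single⇒proportional w w≢0 w' (λ x x⊥w →
    let (x' , x'⊥w' , x≈x') = w⊆w' (lincomb x G) (x , x⊥w , ≈-refl) in
    trans (dot-congˡ w' (lincomb-injective G G-indep x x' x≈x')) x'⊥w')

funToFin-cong : ∀ {m n} {f g : Fin m → Fin n} → (∀ l → f l ≡ g l) → funToFin f ≡ funToFin g
funToFin-cong {zero}        f≗g = refl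
funToFin-cong {suc m} {n} f≗g = cong₂ (combine {n}) (f≗g zero) (funToFin-cong (λ l → f≗g (suc l)))

module ProjectivePoints (𝔽 : FiniteField) where
  open FiniteField 𝔽
  open LinAlg 𝔽
  open Duality 𝔽 public
  open Inverse enum using (to; from; strictlyInverseˡ; strictlyInverseʳ)
  open ≡-Reasoning

  affine : ∀ {m} → Fin (q ^ m) → Vec m
  affine a l = to (finToFun a l)

  -- Normalised representatives of the points of PG(m-1, q): the first non-zero coordinate is 1.
  -- Splitting on whether it is the very first coordinate gives [m+1]_q = q^m + [m]_q.
  mutual
    point : ∀ m → Fin (gauss q m) → Vec m
    point (suc m) i = point′ m (splitAt (q ^ m) i)

    point′ : ∀ m → Fin (q ^ m) ⊎ Fin (gauss q m) → Vec (suc m)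
    point′ m (inj₁ a) = 1# ∷ affine a
    point′ m (inj₂ b) = 0# ∷ point m b

  point-nonzero : ∀ m i → ¬ (point m i ≈ 0v)
  point-nonzero (suc m) i = nonzero (splitAt (q ^ m) i)
    where
    nonzero : ∀ x → ¬ (point′ m x ≈ 0v)
    nonzero (inj₁ a) p≈0 = 1≢0 (p≈0 zero)
    nonzero (inj₂ b) p≈0 = point-nonzero m b (λ l → p≈0 (suc l))

  Normalizable : ∀ m → Vec m → Set
  Normalizable m v = Σ (Fin (gauss q m)) (λ i → Σ Carrier (λ c → ¬ (c ≡ 0#) × v ≈ (c · point m i)))

  opaque
    normalize : ∀ m (v : Vec m) → ¬ (v ≈ 0v) → Normalizable m v
    normalize zero v v≢0 = ⊥-elim (v≢0 (λ ()))
    normalize (suc m) v v≢0 with v zero ≟ 0#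
    ... | no c≢0 = join (q ^ m) (gauss q m) (inj₁ a) , c , c≢0 , v≈
      where
      c : Carrier
      c = v zero
      a : Fin (q ^ m)
      a = funToFin (λ l → from (v (suc l) * inv c c≢0))
      v≈ : v ≈ (c · point (suc m) (join (q ^ m) (gauss q m) (inj₁ a)))
      v≈ l rewrite FinP.splitAt-join (q ^ m) (gauss q m) (inj₁ a) with l
      ... | zero   = sym (*-identityʳ c)
      ... | suc l′ = sym (begin
          c * to (finToFun a l′)                 ≡⟨ cong (λ z → c * to z) (FinP.finToFun-funToFin _ l′) ⟩
          c * to (from (v (suc l′) * inv c c≢0)) ≡⟨ cong (c *_) (strictlyInverseˡ _) ⟩
          c * (v (suc l′) * inv c c≢0)           ≡⟨ *-swapˡ c _ _ ⟩
          v (suc l′) * (c * inv c c≢0)           ≡⟨ cong (v (suc l′) *_) (inv-inverseʳ c c≢0) ⟩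
          v (suc l′) * 1#                        ≡⟨ *-identityʳ _ ⟩
          v (suc l′)                             ∎)
    ... | yes v₀≡0 with normalize m (λ l → v (suc l)) (λ tail≈0 → v≢0 (λ { zero → v₀≡0 ; (suc l) → tail≈0 l }))
    ... | (b , c , c≢0 , tail≈) = join (q ^ m) (gauss q m) (inj₂ b) , c , c≢0 , v≈
      where
      v≈ : v ≈ (c · point (suc m) (join (q ^ m) (gauss q m) (inj₂ b)))
      v≈ l rewrite FinP.splitAt-join (q ^ m) (gauss q m) (inj₂ b) with l
      ... | zero   = trans v₀≡0 (sym (zeroʳ c))
      ... | suc l′ = tail≈ l′

  point-injective : ∀ m i j c → point m i ≈ (c · point m j) → i ≡ j
  point-injective (suc m) i j c p≈ = begin
    i                                                     ≡⟨ sym (FinP.join-splitAt (q ^ m) (gauss q m) i) ⟩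
    join (q ^ m) (gauss q m) (splitAt (q ^ m) i)
      ≡⟨ cong (join (q ^ m) (gauss q m)) (injective′ (splitAt (q ^ m) i) (splitAt (q ^ m) j) p≈) ⟩
    join (q ^ m) (gauss q m) (splitAt (q ^ m) j)          ≡⟨ FinP.join-splitAt (q ^ m) (gauss q m) j ⟩
    j                                                     ∎
    where
    injective′ : ∀ x y → point′ m x ≈ (c · point′ m y) → x ≡ y
    injective′ (inj₁ a) (inj₁ b) p≈ = cong inj₁ (begin
      a                             ≡⟨ sym (FinP.funToFin-finToFin {m} {q} a) ⟩
      funToFin (finToFun {q} {m} a) ≡⟨ funToFin-cong same-digits ⟩
      funToFin (finToFun {q} {m} b) ≡⟨ FinP.funToFin-finToFin {m} {q} b ⟩
      b                             ∎)
      where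
      c≡1 : c ≡ 1#
      c≡1 = trans (sym (*-identityʳ c)) (sym (p≈ zero))
      same-digits : ∀ l → finToFun a l ≡ finToFun b l
      same-digits l = trans (sym (strictlyInverseʳ _))
        (trans (cong from (trans (p≈ (suc l)) (trans (cong (_* _) c≡1) (*-identityˡ _)))) (strictlyInverseʳ _))
    injective′ (inj₁ a) (inj₂ b) p≈ = ⊥-elim (1≢0 (trans (p≈ zero) (zeroʳ c)))
    injective′ (inj₂ a) (inj₁ b) p≈ = ⊥-elim (point-nonzero m a (λ l → trans (p≈ (suc l)) (trans (cong (_* _) c≡0) (zeroˡ _))))
      where
      c≡0 : c ≡ 0#
      c≡0 = trans (sym (*-identityʳ c)) (sym (p≈ zero))
    injective′ (inj₂ a) (inj₂ b) p≈ = cong inj₂ (point-injective m a b c (λ l → p≈ (suc l)))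

module LineProperties (𝔽 : FiniteField) where
  open FiniteField 𝔽
  open LinAlg 𝔽
  open ProjectivePoints 𝔽 public

  LineEq-sym : ∀ {n k} (L L' : Line n k) → LineEq L L' → LineEq L' L
  LineEq-sym L L' L≡L' K = proj₂ (L≡L' K) , proj₁ (L≡L' K)

  LineEq-trans : ∀ {n k} (L L' L'' : Line n k) → LineEq L L' → LineEq L' L'' → LineEq L L''
  LineEq-trans L L' L'' L≡L' L'≡L'' K =
    (λ x → proj₁ (L'≡L'' K) (proj₁ (L≡L' K) x)) , (λ x → proj₂ (L≡L' K) (proj₂ (L'≡L'' K) x))

  same-ends⇒LineEq : ∀ {n k} (L L' : Line n k) → (∀ v → Line.S L v ⇔ Line.S L' v) → (∀ v → Line.U' L v ⇔ Line.U' L' v) →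
                     LineEq L L'
  same-ends⇒LineEq L L' S⇔ U'⇔ K =
    (λ (K-dim , S⊆K , K⊆U') → K-dim , (λ v s → S⊆K v (proj₂ (S⇔ v) s)) , (λ v k → proj₁ (U'⇔ v) (K⊆U' v k))) ,
    (λ (K-dim , S⊆K , K⊆U') → K-dim , (λ v s → S⊆K v (proj₁ (S⇔ v) s)) , (λ v k → proj₂ (U'⇔ v) (K⊆U' v k)))

  module _ {n k₁} (L : Line n (suc k₁)) where
    open Line L

    private
      S-basis : Fam k₁ n
      S-basis = basis dimS

    S+u-InLine : ∀ u → U' u → ¬ S u → InLine L (Span (u ∷ S-basis))
    S+u-InLine u u∈U' u∉S =
      Span-HasDim (u ∷ S-basis) (LinIndep-∷ S-basis u (basis-indep dimS) (λ s → u∉S (fromSpan dimS u s))) ,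
      (λ v v∈S → Span-tail u S-basis v (toSpan dimS v v∈S)) ,
      Span⊆HasDim dimU' (u ∷ S-basis) (λ { zero → u∈U' ; (suc i) → S⊆U' _ (basis-member dimS i) })

    U'∖S-nonempty : Σ (Vec n) (λ u → U' u × ¬ S u)
    U'∖S-nonempty =
      let (u , u∈U' , u∉S) = ∃-outside-Span dimU' S-basis (ℕP.n≤1+n (suc k₁))
      in u , u∈U' , (λ s → u∉S (toSpan dimS u s))

    U'-covered : ∀ v → U' v → Σ (Pred n) (λ K → InLine L K × K v)
    U'-covered v v∈U' with HasDim-dec dimS v
    ... | no v∉S  = _ , S+u-InLine v v∈U' v∉S , Span-member (v ∷ S-basis) zero
    ... | yes v∈S = let (u , u∈U' , u∉S) = U'∖S-nonempty in
                    _ , S+u-InLine u u∈U' u∉S , proj₁ (proj₂ (S+u-InLine u u∈U' u∉S)) v v∈S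

    S-separated : ∀ v → ¬ S v → Σ (Pred n) (λ K → InLine L K × ¬ K v)
    S-separated v v∉S with HasDim-dec dimU' v
    ... | no v∉U' = let (u , u∈U' , u∉S) = U'∖S-nonempty in
                    _ , S+u-InLine u u∈U' u∉S , (λ v∈K → v∉U' (proj₂ (proj₂ (S+u-InLine u u∈U' u∉S)) v v∈K))
    ... | yes v∈U' =
      let (u , u∈U' , u∉S+v) = ∃-outside-Span dimU' (v ∷ S-basis) ℕP.≤-refl
          u∉S = λ s → u∉S+v (Span-tail v S-basis u (toSpan dimS u s))
      in _ , S+u-InLine u u∈U' u∉S ,
         (λ v∈S+u → u∉S+v (exchange S-basis u v v∈S+u (λ s → v∉S (fromSpan dimS v s))))

  LineEq⇒S⊆ : ∀ {n k₁} (L L' : Line n (suc k₁)) → LineEq L L' → Line.S L ⊆ Line.S L'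
  LineEq⇒S⊆ L L' L≡L' v v∈S with HasDim-dec (Line.dimS L') v
  ... | yes v∈S' = v∈S'
  ... | no v∉S'  = let (K , K∈L' , v∉K) = S-separated L' v v∉S' in
                   ⊥-elim (v∉K (proj₁ (proj₂ (proj₂ (L≡L' K) K∈L')) v v∈S))

  LineEq⇒U'⊆ : ∀ {n k₁} (L L' : Line n (suc k₁)) → LineEq L L' → Line.U' L ⊆ Line.U' L'
  LineEq⇒U'⊆ L L' L≡L' v v∈U' = let (K , K∈L , v∈K) = U'-covered L v v∈U' in
                                proj₂ (proj₂ (proj₁ (L≡L' K) K∈L)) v v∈K

  -- A line through K = Span B is determined by its S, a hyperplane of K given by a point of PG(K*),
  -- and by its U' = K + ⟨h⟩, given by the point of PG(H) spanned by the H-component of h.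
  module LinesThrough {n k₁} (B : Fam (suc k₁) n) (B-indep : LinIndep B) where
    open Complement B B-indep
    open ≡-Reasoning

    extension : Vec s → Pred n
    extension z = Span (lincomb z H ∷ B)

    extension-HasDim : ∀ z → ¬ (z ≈ 0v) → HasDim (extension z) (suc (suc k₁))
    extension-HasDim z z≢0 = Span-HasDim (lincomb z H ∷ B)
      (LinIndep-∷ B _ B-indep (λ z∈B → z≢0 (≈-trans (≈-sym (coord-H z)) (Span-B⇒coord≈0 _ z∈B))))

    Hyp⊆Span : ∀ w → Hyp B w ⊆ Span B
    Hyp⊆Span w v (c , _ , v≈) = c , v≈

    line : ∀ w z → ¬ (w ≈ 0v) → ¬ (z ≈ 0v) → Line n (suc k₁)
    line w z w≢0 z≢0 = record
      { S = Hyp B w ; U' = extension z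
      ; dimS = Hyp-HasDim B B-indep w w≢0 ; dimU' = extension-HasDim z z≢0
      ; S⊆U' = λ v v∈S → Span-tail _ B v (Hyp⊆Span w v v∈S) }

    lineAt : Fin (gauss q (suc k₁)) × Fin (gauss q s) → Line n (suc k₁)
    lineAt (a , b) = line (point _ a) (point s b) (point-nonzero _ a) (point-nonzero s b)

    lines : Fin (gauss q (suc k₁) ℕ.* gauss q s) → Line n (suc k₁)
    lines i = lineAt (remQuot {gauss q (suc k₁)} (gauss q s) i)

    lineAt-contains : ∀ ab → InLine (lineAt ab) (Span B)
    lineAt-contains (a , b) = Span-HasDim B B-indep , Hyp⊆Span (point _ a) , Span-tail (lincomb (point s b) H) B

    lines-contain : ∀ i → InLine (lines i) (Span B)
    lines-contain i = lineAt-contains (remQuot {gauss q (suc k₁)} (gauss q s) i)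

    extension⇒proportional : ∀ z z' → extension z' (lincomb z H) → Σ Carrier (λ μ → z ≈ (μ · z'))
    extension⇒proportional z z' (d , z≈) = d zero , λ j → begin
      z j                                         ≡⟨ sym (coord-H z j) ⟩
      coord (lincomb z H) j                       ≡⟨ dot-congˡ (Z j) z≈ ⟩
      coord (lincomb d (lincomb z' H ∷ B)) j      ≡⟨ coord-∷ (lincomb z' H) d j ⟩
      d zero * coord (lincomb z' H) j             ≡⟨ cong (d zero *_) (coord-H z' j) ⟩
      d zero * z' j                               ∎

    lines-injective : ∀ i j → LineEq (lines i) (lines j) → i ≡ j
    lines-injective i j i≡j = begin
      i                        ≡⟨ sym (FinP.combine-remQuot {gauss q (suc k₁)} (gauss q s) i) ⟩
      uncurry′ combine (index i) ≡⟨ cong₂ combine a≡a' b≡b' ⟩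
      uncurry′ combine (index j) ≡⟨ FinP.combine-remQuot {gauss q (suc k₁)} (gauss q s) j ⟩
      j                        ∎
      where
      index = remQuot {gauss q (suc k₁)} (gauss q s)
      a = proj₁ (index i)
      b = proj₂ (index i)
      a' = proj₁ (index j)
      b' = proj₂ (index j)
      a≡a' : a ≡ a'
      a≡a' = let (μ , p≈) = Hyp⊆⇒proportional B B-indep (point _ a) (point _ a') (point-nonzero _ a)
                                                (LineEq⇒S⊆ (lines i) (lines j) i≡j) in
             sym (point-injective _ a' a μ p≈)
      b≡b' : b ≡ b'
      b≡b' = let (μ , p≈) = extension⇒proportional (point s b) (point s b')
                              (LineEq⇒U'⊆ (lines i) (lines j) i≡j _ (Span-member (lincomb (point s b) H ∷ B) zero)) in
             point-injective s b b' μ p≈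

    hyperplane-is-point : ∀ {S : Pred n} → HasDim S k₁ → S ⊆ Span B →
                          Σ (Fin (gauss q (suc k₁))) (λ a → ∀ v → S v ⇔ Hyp B (point _ a) v)
    hyperplane-is-point S-dim S⊆B =
      let (w , w≢0 , S⇔w) = codim1⇒Hyp B B-indep S-dim S⊆B
          (a , λ₀ , λ₀≢0 , w≈) = normalize _ w w≢0
          w⇔a = Hyp-scale B λ₀ λ₀≢0 w≈
      in a , λ v → (λ v∈S → proj₁ (w⇔a v) (proj₁ (S⇔w v) v∈S)) , (λ v∈a → proj₂ (S⇔w v) (proj₂ (w⇔a v) v∈a))

    superspace-is-point : ∀ {U' : Pred n} → HasDim U' (suc (suc k₁)) → Span B ⊆ U' →
                          Σ (Fin (gauss q s)) (λ b → ∀ v → U' v ⇔ extension (point s b) v)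
    superspace-is-point {U'} U'-dim B⊆U' = b , λ v → ⊆-sameDim⇒⊇ U'-dim (extension-HasDim z (point-nonzero s b)) ext⊆U' v , ext⊆U' v
      where
      outside = ∃-outside-Span U'-dim B ℕP.≤-refl
      u = proj₁ outside
      u∉B = proj₂ (proj₂ outside)
      normal = normalize s (coord u) (λ coord≈0 → u∉B (coord≈0⇒Span-B u coord≈0))
      b = proj₁ normal
      κ = proj₁ (proj₂ normal)
      κ≢0 = proj₁ (proj₂ (proj₂ normal))
      z = point s b
      z-part : Span (u ∷ B) (lincomb z H)
      z-part = Span-resp (u ∷ B) (λ l → begin
        inv κ κ≢0 * lincomb (coord u) H l    ≡⟨ cong (inv κ κ≢0 *_) (lincomb-congˡ H (proj₂ (proj₂ (proj₂ normal))) l) ⟩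
        inv κ κ≢0 * lincomb (κ · z) H l      ≡⟨ cong (inv κ κ≢0 *_) (lincomb-· κ z H l) ⟩
        inv κ κ≢0 * (κ * lincomb z H l)      ≡⟨ inv-cancelˡ κ κ≢0 _ ⟩
        lincomb z H l                        ∎) (Span-· (u ∷ B) (inv κ κ≢0) (complement-part u))
      u∷B⊆U' : Span (u ∷ B) ⊆ U'
      u∷B⊆U' = Span⊆HasDim U'-dim (u ∷ B) (λ { zero → proj₁ (proj₂ outside) ; (suc i) → B⊆U' _ (Span-member B i) })
      ext⊆U' : extension z ⊆ U'
      ext⊆U' = Span⊆HasDim U'-dim (lincomb z H ∷ B) (λ { zero → u∷B⊆U' _ z-part ; (suc i) → B⊆U' _ (Span-member B i) })

    lines-complete : ∀ L → InLine L (Span B) → Σ (Fin (gauss q (suc k₁) ℕ.* gauss q s)) (λ i → LineEq L (lines i))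
    lines-complete L (_ , S⊆B , B⊆U') =
      let (a , S⇔) = hyperplane-is-point (Line.dimS L) S⊆B
          (b , U'⇔) = superspace-is-point (Line.dimU' L) B⊆U'
      in combine a b , subst (λ ab → LineEq L (lineAt ab)) (sym (FinP.remQuot-combine a b))
                             (same-ends⇒LineEq L (lineAt (a , b)) S⇔ U'⇔)

  ExactlyLines : ∀ {n k ℓ} → (Line n k → Set ℓ) → ℕ → Set (lsuc 0ℓ ⊔ ℓ)
  ExactlyLines {n} {k} P N = Σ (Fin N → Line n k) (λ Ls →
    (∀ i → P (Ls i)) × (∀ i j → LineEq (Ls i) (Ls j) → i ≡ j) × (∀ L → P L → L ∈ᴸ (N , Ls)))

  ExactlyLines-⇔ : ∀ {n k ℓ ℓ'} {P : Line n k → Set ℓ} {Q : Line n k → Set ℓ'} {N} → (∀ L → (P L → Q L) × (Q L → P L)) →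
                   ExactlyLines P N → ExactlyLines Q N
  ExactlyLines-⇔ P⇔Q (Ls , P-Ls , Ls-injective , P-complete) =
    Ls , (λ i → proj₁ (P⇔Q (Ls i)) (P-Ls i)) , Ls-injective , (λ L QL → P-complete L (proj₂ (P⇔Q L) QL))

  distinct-lines-≤ : ∀ {n k a b} (E : Fin a → Line n k) → (∀ i j → LineEq (E i) (E j) → i ≡ j) →
                     (Ls : Fin b → Line n k) → (∀ i → E i ∈ᴸ (b , Ls)) → a ≤ b
  distinct-lines-≤ E E-injective Ls E⊆Ls = FinP.injective⇒≤ {f = λ i → proj₁ (E⊆Ls i)} λ {i} {j} same →
    E-injective i j (LineEq-trans (E i) (Ls _) (E j) (proj₂ (E⊆Ls i))
      (LineEq-sym (E j) (Ls _) (subst (λ x → LineEq (E j) (Ls x)) (sym same) (proj₂ (E⊆Ls j)))))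

  ExactlyLines-unique : ∀ {n k ℓ} {P : Line n k → Set ℓ} {a b} → ExactlyLines P a → ExactlyLines P b → a ≡ b
  ExactlyLines-unique (Ls , P-Ls , Ls-injective , P-complete) (Ls' , P-Ls' , Ls'-injective , P-complete') =
    ℕP.≤-antisym (distinct-lines-≤ Ls Ls-injective Ls' (λ i → P-complete' (Ls i) (P-Ls i)))
                 (distinct-lines-≤ Ls' Ls'-injective Ls (λ i → P-complete (Ls' i) (P-Ls' i)))

  InLine-⇔ : ∀ {n k} (L : Line n k) {K K' : Pred n} → (∀ v → K v ⇔ K' v) → InLine L K → InLine L K'
  InLine-⇔ L K⇔K' (K-dim , S⊆K , K⊆U') =
    HasDim-⇔ K-dim K⇔K' , (λ v s → proj₁ (K⇔K' v) (S⊆K v s)) , (λ v k → K⊆U' v (proj₂ (K⇔K' v) k))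

  lines-through-count : ∀ {n k₁} {K : Pred n} → HasDim K (suc k₁) →
                        ExactlyLines (λ L → InLine L K) (gauss q (suc k₁) ℕ.* gauss q (n ∸ suc k₁))
  lines-through-count {n} {k₁} {K} K-dim = subst (ExactlyLines (λ L → InLine L K)) (cong (λ m → gauss q (suc k₁) ℕ.* gauss q m) s≡)
    (lines , (λ i → InLine-⇔ (lines i) Span⇔K (lines-contain i)) , lines-injective ,
     (λ L L∋K → lines-complete L (InLine-⇔ L K⇔Span L∋K)))
    where
    open LinesThrough (basis K-dim) (basis-indep K-dim)
    open Complement (basis K-dim) (basis-indep K-dim) using (s; size)
    K⇔Span : ∀ v → K v ⇔ Span (basis K-dim) v
    K⇔Span v = toSpan K-dim v , fromSpan K-dim v
    Span⇔K : ∀ v → Span (basis K-dim) v ⇔ K v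
    Span⇔K v = fromSpan K-dim v , toSpan K-dim v
    s≡ : s ≡ n ∸ suc k₁
    s≡ = trans (sym (ℕP.m+n∸n≡m s (suc k₁))) (cong (_∸ suc k₁) size)

module Codes (𝔽 : FiniteField) {n k : ℕ} (M : Fin (suc k) → LinAlg.Vec 𝔽 n)
             (M-indep : LinAlg.LinIndep 𝔽 M) (M-projective : LinAlg.ProjectiveMatrix 𝔽 M) where
  open FiniteField 𝔽
  open LinAlg 𝔽
  open LineProperties 𝔽 public
  open ≡-Reasoning

  l : Fin n → Vec (suc k)
  l = column M

  U : Pred n
  U = Span M

  C⊆U : ∀ y → C M y ⊆ U
  C⊆U y v (c , _ , v≈) = c , v≈

  C-HasDim : ∀ y → ¬ (y ≈ 0v) → HasDim (C M y) k
  C-HasDim = Hyp-HasDim M M-indep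

  relation⇒y≈ : ∀ {y} a b c t (t≢0 : ¬ (t ≡ 0#)) → (l a ⊕ ((- c) · l b)) ≈ (t · y) →
                y ≈ ((inv t t≢0 · l a) ⊕ ((inv t t≢0 * - c) · l b))
  relation⇒y≈ {y} a b c t t≢0 rel i = begin
    y i                                  ≡⟨ sym (inv-cancelˡ t t≢0 (y i)) ⟩
    t⁻¹ * (t * y i)                      ≡⟨ cong (t⁻¹ *_) (sym (rel i)) ⟩
    t⁻¹ * (l a i + (- c) * l b i)        ≡⟨ distribˡ t⁻¹ _ _ ⟩
    t⁻¹ * l a i + t⁻¹ * ((- c) * l b i)  ≡⟨ cong (t⁻¹ * l a i +_) (sym (*-assoc t⁻¹ (- c) (l b i))) ⟩
    t⁻¹ * l a i + (t⁻¹ * - c) * l b i    ∎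
    where t⁻¹ = inv t t≢0

  -- t = 0 contradicts projectivity of M (a zero column is the case a = b, c = 0), and t ≠ 0
  -- writes y as a combination of at most two columns of M.
  relation⇒¬Y : ∀ {y} → InY M y → ∀ a b c t → ¬ (a ≡ b) ⊎ c ≡ 0# → (l a ⊕ ((- c) · l b)) ≈ (t · y) → ⊥
  relation⇒¬Y {y} ((y≢0 , y∉W) , y∉Y) a b c t a≢b⊎c≡0 rel with t ≟ 0# | c ≟ 0#
  ... | yes t≡0 | _ = M-contradiction a≢b⊎c≡0
    where
    la≈ : l a ≈ (c · l b)
    la≈ i = trans (+-inverseʳ-unique _ _ (trans (+-comm _ _) (trans (rel i) (trans (cong (_* y i) t≡0) (zeroˡ _)))))
                  (trans (cong -_ (sym (-‿distribˡ-* c (l b i)))) (-‿involutive _))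
    M-contradiction : ¬ (a ≡ b) ⊎ c ≡ 0# → ⊥
    M-contradiction (inj₁ a≢b) = proj₂ M-projective a b a≢b (c , la≈)
    M-contradiction (inj₂ c≡0) = proj₁ M-projective a (λ i → trans (la≈ i) (trans (cong (_* l b i) c≡0) (zeroˡ _)))
  ... | no t≢0 | yes c≡0 = y∉W a (inv t t≢0 , λ i → trans (relation⇒y≈ a b c t t≢0 rel i) (drop-second i))
    where
    drop-second : ∀ i → inv t t≢0 * l a i + (inv t t≢0 * - c) * l b i ≡ inv t t≢0 * l a i
    drop-second i = begin
      inv t t≢0 * l a i + (inv t t≢0 * - c) * l b i
        ≡⟨ cong (λ x → inv t t≢0 * l a i + (inv t t≢0 * x) * l b i) (trans (cong -_ c≡0) -0#≈0#) ⟩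
      inv t t≢0 * l a i + (inv t t≢0 * 0#) * l b i   ≡⟨ cong (λ x → inv t t≢0 * l a i + x * l b i) (zeroʳ _) ⟩
      inv t t≢0 * l a i + 0# * l b i                  ≡⟨ cong (inv t t≢0 * l a i +_) (zeroˡ _) ⟩
      inv t t≢0 * l a i + 0#                          ≡⟨ +-identityʳ _ ⟩
      inv t t≢0 * l a i                               ∎
  ... | no t≢0 | no c≢0 =
    y∉Y (inv t t≢0) (inv t t≢0 * - c) (inv-nonzero t t≢0) (*-nonzero (inv-nonzero t t≢0) (-‿nonzero c≢0)) a b
        (relation⇒y≈ a b c t t≢0 rel)

  -- Column j of a generator matrix of C(y) is the functional x ↦ x·l_j on y^⊥, so a dependency
  -- between two columns puts l_a − c·l_b into (y^⊥)^⊥ = ⟨y⟩.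
  C-projective : ∀ {y} → InY M y → (G : Fam k n) → C M y ⊆ Span G → ProjectiveMatrix G
  C-projective {y} y∈Y G C⊆G =
    (λ a a≈0 → let (t , rel) = relation a a 0# (λ r → trans (a≈0 r) (sym (zeroˡ _))) in
               relation⇒¬Y y∈Y a a 0# t (inj₂ refl) rel) ,
    (λ a b a≢b (c , a≈cb) → let (t , rel) = relation a b c a≈cb in
                            relation⇒¬Y y∈Y a b c t (inj₁ a≢b) rel)
    where
    relation : ∀ a b c → column G a ≈ (c · column G b) → Σ Carrier (λ t → (l a ⊕ ((- c) · l b)) ≈ (t · y))
    relation a b c a≈cb = Perp-single⇒proportional y (proj₁ (proj₁ y∈Y)) _ (λ x x⊥y →
      let (μ , x≈) = C⊆G (lincomb x M) (x , x⊥y , ≈-refl)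
          la≡c*lb : dot x (l a) ≡ c * dot x (l b)
          la≡c*lb = begin
            lincomb x M a                    ≡⟨ x≈ a ⟩
            sumF (λ r → μ r * G r a)         ≡⟨ sumF-cong (λ r → trans (cong (μ r *_) (a≈cb r)) (*-swapˡ (μ r) c (G r b))) ⟩
            sumF (λ r → c * (μ r * G r b))   ≡⟨ sym (*-distribˡ-sumF c (λ r → μ r * G r b)) ⟩
            c * sumF (λ r → μ r * G r b)     ≡⟨ cong (c *_) (sym (x≈ b)) ⟩
            c * lincomb x M b                ∎
      in begin
        dot x (l a ⊕ ((- c) · l b))          ≡⟨ trans (dot-⊕ʳ x (l a) ((- c) · l b)) (cong (dot x (l a) +_) (dot-·ʳ x (l b) (- c))) ⟩
        dot x (l a) + (- c) * dot x (l b)    ≡⟨ cong₂ _+_ la≡c*lb (sym (-‿distribˡ-* c _)) ⟩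
        c * dot x (l b) + - (c * dot x (l b)) ≡⟨ -‿inverseʳ _ ⟩
        0#                                   ∎)

  C-InProjPart : ∀ y → InY M y → InProjPart U k (C M y)
  C-InProjPart y y∈Y = (basis C-dim , basis-indep C-dim , C-projective y∈Y (basis C-dim) (toSpan C-dim) ,
                        λ v → toSpan C-dim v , fromSpan C-dim v) , C⊆U y
    where C-dim = C-HasDim y (proj₁ (proj₁ y∈Y))

  projective⇒Y : ∀ {y} (G : Fam k n) → ProjectiveMatrix G → ¬ (y ≈ 0v) → (∀ r → C M y (G r)) → InY M y
  projective⇒Y {y} G (no-zero-column , no-proportional) y≢0 G⊆C = (y≢0 , y∉W) , y∉Y
    where
    A = λ r → proj₁ (G⊆C r)
    A⊥y : ∀ r → dot (A r) y ≡ 0#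
    A⊥y r = proj₁ (proj₂ (G⊆C r))
    G-entry : ∀ r j → G r j ≡ dot (A r) (l j)
    G-entry r j = proj₂ (proj₂ (G⊆C r)) j
    y∉W : ∀ j → ¬ Proportional y (l j)
    y∉W j (c , y≈) with c ≟ 0#
    ... | yes c≡0 = y≢0 (λ i → trans (y≈ i) (trans (cong (_* l j i) c≡0) (zeroˡ _)))
    ... | no c≢0 = no-zero-column j (λ r → trans (G-entry r j) (*-zero-nonzeroˡ c c≢0
                     (trans (sym (dot-·ʳ (A r) (l j) c)) (trans (dot-congʳ (A r) (≈-sym y≈)) (A⊥y r)))))
    y∉Y : ∀ α β → ¬ (α ≡ 0#) → ¬ (β ≡ 0#) → ∀ i j → ¬ (y ≈ ((α · l i) ⊕ (β · l j)))
    y∉Y α β α≢0 β≢0 i j y≈ with i FinP.≟ j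
    ... | yes refl = y∉W i ((α + β) , λ x → trans (y≈ x) (sym (distribʳ (l i x) α β)))
    ... | no i≢j = no-proportional i j i≢j (- (inv α α≢0 * β) , λ r → trans (G-entry r i)
            (trans (solve-for-first α β _ _ α≢0 (trans (sym (dot-linearʳ (A r) (l i) (l j) α β))
                                                       (trans (dot-congʳ (A r) (≈-sym y≈)) (A⊥y r))))
                   (cong (- (inv α α≢0 * β) *_) (sym (G-entry r j)))))

  InProjPart⇒C : ∀ K → InProjPart U k K → Σ (Vec (suc k)) (λ y → InY M y × (∀ v → K v ⇔ C M y v))
  InProjPart⇒C K ((G , G-indep , G-projective , K⇔G) , K⊆U) =
    let (y , y≢0 , K⇔C) = codim1⇒Hyp M M-indep K-dim K⊆U
    in y , projective⇒Y G G-projective y≢0 (λ r → proj₁ (K⇔C (G r)) (proj₂ (K⇔G (G r)) (Span-member G r))) , K⇔C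
    where
    K-dim : HasDim K k
    K-dim = G , G-indep , K⇔G

module Classification (𝔽 : FiniteField) {n k₁ : ℕ} (M : Fin (suc (suc k₁)) → LinAlg.Vec 𝔽 n)
                      (M-indep : LinAlg.LinIndep 𝔽 M) (M-projective : LinAlg.ProjectiveMatrix 𝔽 M) where
  open FiniteField 𝔽
  open LinAlg 𝔽
  open Codes 𝔽 M M-indep M-projective public

  InY-resp : Resp (InY M)
  InY-resp w≈w' ((w≢0 , w∉W) , w∉Y) =
    ((λ w'≈0 → w≢0 (≈-trans w≈w' w'≈0)) , (λ j (c , w'≈) → w∉W j (c , ≈-trans w≈w' w'≈))) ,
    (λ α β α≢0 β≢0 i j w'≈ → w∉Y α β α≢0 β≢0 i j (≈-trans w≈w' w'≈))

  InY? : ∀ w → Dec (InY M w)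
  InY? w =
    (¬? (w ≈? 0v) ×-dec FinP.all? (λ j → ¬? (∃-Carrier? (λ c → w ≈ (c · l j)) (λ c → w ≈? (c · l j))))) ×-dec
    ∀-Carrier? _ (λ α → ∀-Carrier? _ (λ β → ¬? (α ≟ 0#) →-dec ¬? (β ≟ 0#) →-dec
      FinP.all? (λ i → FinP.all? (λ j → ¬? (w ≈? ((α · l i) ⊕ (β · l j)))))))

  Y-outside? : ∀ {m} (B : Fam m (suc (suc k₁))) → Dec (Σ (Vec (suc (suc k₁))) (λ y → InY M y × ¬ Span B y))
  Y-outside? B = ∃-Vec? _ _ (λ y≈y' (y∈Y , y∉B) → InY-resp y≈y' y∈Y , (λ y'∈B → y∉B (Span-resp B (≈-sym y≈y') y'∈B)))
                         (λ y → InY? y ×-dec ¬? (Span? B y))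

  Y⊆Span : ∀ {m} (B : Fam m (suc (suc k₁))) → ¬ Σ (Vec (suc (suc k₁))) (λ y → InY M y × ¬ Span B y) →
           ∀ y → InY M y → Span B y
  Y⊆Span B nothing-outside y y∈Y = decidable-stable (Span? B y) (λ y∉B → nothing-outside (y , y∈Y , y∉B))

  data YShape : Set where
    Y-empty : (∀ y → ¬ InY M y) → YShape
    Y-rank1  : ∀ y₁ → InY M y₁ → (∀ y → InY M y → Span (y₁ ∷ []) y) → YShape
    Y-rank2 : ∀ y₁ y₂ → InY M y₁ → InY M y₂ → LinIndep (y₂ ∷ y₁ ∷ []) →
              (∀ y → InY M y → Span (y₂ ∷ y₁ ∷ []) y) → YShape
    Y-rank≥3 : ∀ y₁ y₂ y₃ → InY M y₁ → InY M y₂ → InY M y₃ → LinIndep (y₃ ∷ y₂ ∷ y₁ ∷ []) → YShape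

  rank2-or-more : ∀ y₁ y₂ → InY M y₁ → InY M y₂ → LinIndep (y₂ ∷ y₁ ∷ []) → YShape
  rank2-or-more y₁ y₂ y₁∈Y y₂∈Y independent with Y-outside? (y₂ ∷ y₁ ∷ [])
  ... | no inside = Y-rank2 y₁ y₂ y₁∈Y y₂∈Y independent (Y⊆Span (y₂ ∷ y₁ ∷ []) inside)
  ... | yes (y₃ , y₃∈Y , y₃∉) =
    Y-rank≥3 y₁ y₂ y₃ y₁∈Y y₂∈Y y₃∈Y (LinIndep-∷ (y₂ ∷ y₁ ∷ []) y₃ independent y₃∉)

  classify : YShape
  classify with ∃-Vec? _ (InY M) InY-resp InY?
  ... | no no-Y = Y-empty (λ y y∈Y → no-Y (y , y∈Y))
  ... | yes (y₁ , y₁∈Y) with Y-outside? (y₁ ∷ [])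
  ...   | no inside = Y-rank1 y₁ y₁∈Y (Y⊆Span (y₁ ∷ []) inside)
  ...   | yes (y₂ , y₂∈Y , y₂∉) =
    rank2-or-more y₁ y₂ y₁∈Y y₂∈Y (LinIndep-∷ (y₁ ∷ []) y₂ (LinIndep-single y₁ (proj₁ (proj₁ y₁∈Y))) y₂∉)

  ⟨Y⟩ : Pred (suc (suc k₁))
  ⟨Y⟩ = SpanSet (InY M)

  Y⊆⟨Y⟩ : ∀ y → InY M y → ⟨Y⟩ y
  Y⊆⟨Y⟩ y y∈Y = 1 , (y ∷ []) , (λ { zero → y∈Y }) , Span-member (y ∷ []) zero

  ⟨Y⟩-HasDim : ∀ {d} (B : Fam d (suc (suc k₁))) → LinIndep B → (∀ i → InY M (B i)) → (∀ y → InY M y → Span B y) →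
               HasDim ⟨Y⟩ d
  ⟨Y⟩-HasDim {d} B B-indep B⊆Y Y⊆B = B , B-indep , λ v →
    (λ (m , ys , ys⊆Y , v∈ys) → Span-mono ys B (λ i → Y⊆B (ys i) (ys⊆Y i)) v v∈ys) , (λ v∈B → d , B , B⊆Y , v∈B)

module Cases (𝔽 : FiniteField) {n k₁ : ℕ} (M : Fin (suc (suc k₁)) → LinAlg.Vec 𝔽 n)
                (M-indep : LinAlg.LinIndep 𝔽 M) (M-projective : LinAlg.ProjectiveMatrix 𝔽 M) where
  open FiniteField 𝔽
  open LinAlg 𝔽
  open Classification 𝔽 M M-indep M-projective public

  AllLines : Set₁
  AllLines = (L : Line n (suc k₁)) → ContainedIn U L

  SomeLine : Set₁
  SomeLine = Σ (Line n (suc k₁)) (ContainedIn U)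

  IntervalDescription : Set₁
  IntervalDescription = HasDim (⋂C M) k₁ ×
    ((L : Line n (suc k₁)) → ContainedIn U L → (K : Pred n) → InLine L K ⇔₁ InInterval (⋂C M) U (suc k₁) K)

  Y-empty⇒AllLines : (∀ y → ¬ InY M y) → AllLines
  Y-empty⇒AllLines no-Y L K K∈ = ⊥-elim (no-Y _ (proj₁ (proj₂ (InProjPart⇒C K K∈))))

  Y-empty⇒⟨Y⟩-dim0 : (∀ y → ¬ InY M y) → HasDim ⟨Y⟩ 0
  Y-empty⇒⟨Y⟩-dim0 no-Y = ⟨Y⟩-HasDim [] (λ c h ()) (λ ()) (λ y y∈Y → ⊥-elim (no-Y y y∈Y))

  module OneDimensional (y₁ : Vec (suc (suc k₁))) (y₁∈Y : InY M y₁) (Y⊆y₁ : ∀ y → InY M y → Span (y₁ ∷ []) y) where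
    y₁≢0 : ¬ (y₁ ≈ 0v)
    y₁≢0 = proj₁ (proj₁ y₁∈Y)

    InProjPart⇒C₁ : ∀ K → InProjPart U (suc k₁) K → ∀ v → C M y₁ v ⇔ K v
    InProjPart⇒C₁ K K∈ v =
      (λ v∈C₁ → proj₂ (K⇔Cy v) (proj₂ (Cy⇔C₁ v) v∈C₁)) , (λ v∈K → proj₁ (Cy⇔C₁ v) (proj₁ (K⇔Cy v) v∈K))
      where
      y = proj₁ (InProjPart⇒C K K∈)
      y∈Y = proj₁ (proj₂ (InProjPart⇒C K K∈))
      K⇔Cy = proj₂ (proj₂ (InProjPart⇒C K K∈))
      μ = proj₁ (Span-single y₁ y (Y⊆y₁ y y∈Y))
      y≈ = proj₂ (Span-single y₁ y (Y⊆y₁ y y∈Y))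
      μ≢0 : ¬ (μ ≡ 0#)
      μ≢0 μ≡0 = proj₁ (proj₁ y∈Y) (λ i → trans (y≈ i) (trans (cong (_* y₁ i) μ≡0) (zeroˡ _)))
      Cy⇔C₁ = Hyp-scale M μ μ≢0 y≈

    ContainedIn⇔InLine : ∀ L → (ContainedIn U L → InLine L (C M y₁)) × (InLine L (C M y₁) → ContainedIn U L)
    ContainedIn⇔InLine L = (λ contained → contained (C M y₁) (C-InProjPart y₁ y₁∈Y)) ,
                           (λ L∋C₁ K K∈ → InLine-⇔ L (InProjPart⇒C₁ K K∈) L∋C₁)

    exactly : ContainedInExactly {n} {suc k₁} U (gauss q (suc k₁) ℕ.* gauss q (n ∸ suc k₁))
    exactly = ExactlyLines-⇔ (λ L → proj₂ (ContainedIn⇔InLine L) , proj₁ (ContainedIn⇔InLine L))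
                             (lines-through-count (C-HasDim y₁ y₁≢0))

    ⟨Y⟩-dim1 : HasDim ⟨Y⟩ 1
    ⟨Y⟩-dim1 = ⟨Y⟩-HasDim (y₁ ∷ []) (LinIndep-single y₁ y₁≢0) (λ { zero → y₁∈Y }) Y⊆y₁

  module TwoIndependent (y₁ y₂ : Vec (suc (suc k₁))) (y₁∈Y : InY M y₁) (y₂∈Y : InY M y₂)
               (independent : LinIndep (y₂ ∷ y₁ ∷ [])) where
    pair : Fam 2 (suc (suc k₁))
    pair = y₂ ∷ y₁ ∷ []

    C₁-dim : HasDim (C M y₁) (suc k₁)
    C₁-dim = C-HasDim y₁ (proj₁ (proj₁ y₁∈Y))

    C₂-dim : HasDim (C M y₂) (suc k₁)
    C₂-dim = C-HasDim y₂ (proj₁ (proj₁ y₂∈Y))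

    I : Pred n
    I = Im M (Perp pair)

    I-HasDim : HasDim I k₁
    I-HasDim = Im-HasDim M M-indep _ (Perp-HasDim pair independent (ℕP.+-comm k₁ 2))

    C∩C⇒I : ∀ v → C M y₁ v → C M y₂ v → I v
    C∩C⇒I v (c₁ , c₁⊥y₁ , v≈₁) (c₂ , c₂⊥y₂ , v≈₂) = c₁ , c₁⊥pair , v≈₁
      where
      c₁≈c₂ = lincomb-injective M M-indep c₁ c₂ (≈-trans (≈-sym v≈₁) v≈₂)
      c₁⊥pair : Perp pair c₁
      c₁⊥pair zero       = trans (dot-comm y₂ c₁) (trans (dot-congˡ y₂ c₁≈c₂) c₂⊥y₂)
      c₁⊥pair (suc zero) = trans (dot-comm y₁ c₁) c₁⊥y₁

    C₁⊈C₂ : Σ (Vec n) (λ v → C M y₁ v × ¬ C M y₂ v)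
    C₁⊈C₂ = ⊈⇒∃ C₁-dim C₂-dim (λ C₁⊆C₂ →
      let (μ , y₂≈) = Hyp⊆⇒proportional M M-indep y₁ y₂ (proj₁ (proj₁ y₁∈Y)) C₁⊆C₂ in
      LinIndep-∷⇒∉ (y₁ ∷ []) y₂ independent ((λ _ → μ) , λ i → trans (y₂≈ i) (sym (+-identityʳ _))))

    R : Fam (suc (suc k₁)) n
    R = proj₁ C₁⊈C₂ ∷ basis C₂-dim

    R-HasDim : HasDim (Span R) (suc (suc k₁))
    R-HasDim = Span-HasDim R (LinIndep-∷ (basis C₂-dim) _ (basis-indep C₂-dim)
                                (λ v∈C₂ → proj₂ (proj₂ C₁⊈C₂) (fromSpan C₂-dim _ v∈C₂)))

    R⊆ : ∀ {P : Pred n} {d} → HasDim P d → C M y₁ ⊆ P → C M y₂ ⊆ P → Span R ⊆ P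
    R⊆ P-dim C₁⊆P C₂⊆P = Span⊆HasDim P-dim R λ
      { zero → C₁⊆P _ (proj₁ (proj₂ C₁⊈C₂)) ; (suc i) → C₂⊆P _ (basis-member C₂-dim i) }

    -- S lies in C(y₁) ∩ C(y₂) = I and has the same dimension; U' contains C(y₁) + C(y₂) = U.
    module Contained (L : Line n (suc k₁)) (contained : ContainedIn U L) where
      open Line L

      S⊆C : ∀ y → InY M y → S ⊆ C M y
      S⊆C y y∈Y = proj₁ (proj₂ (contained (C M y) (C-InProjPart y y∈Y)))

      C⊆U' : ∀ y → InY M y → C M y ⊆ U'
      C⊆U' y y∈Y = proj₂ (proj₂ (contained (C M y) (C-InProjPart y y∈Y)))

      S⊆I : S ⊆ I
      S⊆I v v∈S = C∩C⇒I v (S⊆C y₁ y₁∈Y v v∈S) (S⊆C y₂ y₂∈Y v v∈S)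

      I⊆S : I ⊆ S
      I⊆S = ⊆-sameDim⇒⊇ I-HasDim dimS S⊆I

      Y⊆pair : ∀ y → InY M y → Span pair y
      Y⊆pair y y∈Y = Complement.double-perp pair independent y (λ x x⊥pair →
        let (c , c⊥y , x≈c) = S⊆C y y∈Y (lincomb x M) (I⊆S _ (x , x⊥pair , ≈-refl)) in
        trans (dot-comm y x) (trans (dot-congˡ y (lincomb-injective M M-indep x c x≈c)) c⊥y))

      R⊆U : Span R ⊆ U
      R⊆U = R⊆ (Span-HasDim M M-indep) (C⊆U y₁) (C⊆U y₂)

      R⊆U' : Span R ⊆ U'
      R⊆U' = R⊆ dimU' (C⊆U' y₁ y₁∈Y) (C⊆U' y₂ y₂∈Y)

      U'⊆U : U' ⊆ U
      U'⊆U = sandwich dimU' R-HasDim R⊆U' R⊆U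

      U⊆U' : U ⊆ U'
      U⊆U' = sandwich (Span-HasDim M M-indep) R-HasDim R⊆U R⊆U'

    module Spanning (Y⊆pair : ∀ y → InY M y → Span pair y) where
      ⋂C⇔I : ∀ v → ⋂C M v ⇔ I v
      ⋂C⇔I v = (λ v∈⋂ → C∩C⇒I v (v∈⋂ y₁ y₁∈Y) (v∈⋂ y₂ y₂∈Y)) ,
               (λ (c , c⊥pair , v≈) y y∈Y → c , c⊥y c c⊥pair y (Y⊆pair y y∈Y) , v≈)
        where
        c⊥y : ∀ c → Perp pair c → ∀ y → Span pair y → dot c y ≡ 0#
        c⊥y c c⊥pair y (μ , y≈) = trans (dot-congʳ c y≈) (trans (dot-lincombʳ c μ pair)
          (sumF-zero (λ i → trans (cong (μ i *_) (trans (dot-comm c (pair i)) (c⊥pair i))) (zeroʳ (μ i)))))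

      ⋂C-HasDim : HasDim (⋂C M) k₁
      ⋂C-HasDim = HasDim-⇔ I-HasDim (λ v → proj₂ (⋂C⇔I v) , proj₁ (⋂C⇔I v))

      L₀ : Line n (suc k₁)
      L₀ = record { S = ⋂C M ; U' = U ; dimS = ⋂C-HasDim ; dimU' = Span-HasDim M M-indep
                  ; S⊆U' = λ v v∈⋂ → C⊆U y₁ v (v∈⋂ y₁ y₁∈Y) }

      L₀-contained : ContainedIn U L₀
      L₀-contained K K∈@((G , G-indep , _ , K⇔G) , K⊆U) =
        let (y , y∈Y , K⇔C) = InProjPart⇒C K K∈ in
        (G , G-indep , K⇔G) , (λ v v∈⋂ → proj₂ (K⇔C v) (v∈⋂ y y∈Y)) , K⊆U

      contained⇒L₀ : ∀ L → ContainedIn U L → LineEq L L₀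
      contained⇒L₀ L contained = same-ends⇒LineEq L L₀
        (λ v → (λ v∈S → proj₂ (⋂C⇔I v) (S⊆I v v∈S)) , (λ v∈⋂ → I⊆S v (proj₁ (⋂C⇔I v) v∈⋂)))
        (λ v → U'⊆U v , U⊆U' v)
        where open Contained L contained

      exactly-one : ContainedInExactly {n} {suc k₁} U 1
      exactly-one = (λ _ → L₀) , (λ _ → L₀-contained) , (λ { zero zero _ → refl }) ,
                    (λ L contained → zero , contained⇒L₀ L contained)

      interval : IntervalDescription
      interval = ⋂C-HasDim , λ L contained K → contained⇒L₀ L contained K

      ⟨Y⟩-dim2 : HasDim ⟨Y⟩ 2
      ⟨Y⟩-dim2 = ⟨Y⟩-HasDim pair independent (λ { zero → y₂∈Y ; (suc zero) → y₁∈Y }) Y⊆pair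

  module ThreeIndependent (y₁ y₂ y₃ : Vec (suc (suc k₁))) (y₁∈Y : InY M y₁) (y₂∈Y : InY M y₂) (y₃∈Y : InY M y₃)
               (independent : LinIndep (y₃ ∷ y₂ ∷ y₁ ∷ [])) where
    no-line : ¬ SomeLine
    no-line (L , contained) = LinIndep-∷⇒∉ (y₂ ∷ y₁ ∷ []) y₃ independent (Y⊆pair y₃ y₃∈Y)
      where open TwoIndependent y₁ y₂ y₁∈Y y₂∈Y (LinIndep-tail (y₃ ∷ y₂ ∷ y₁ ∷ []) independent)
            open Contained L contained

    ⟨Y⟩-dim≥3 : ∀ {d} → HasDim ⟨Y⟩ d → 3 ≤ d
    ⟨Y⟩-dim≥3 ⟨Y⟩-dim = steinitz (y₃ ∷ y₂ ∷ y₁ ∷ []) independent (basis ⟨Y⟩-dim)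
      (λ i → toSpan ⟨Y⟩-dim _ (Y⊆⟨Y⟩ _ (triple∈Y i)))
      where
      triple∈Y : ∀ i → InY M ((y₃ ∷ y₂ ∷ y₁ ∷ []) i)
      triple∈Y zero             = y₃∈Y
      triple∈Y (suc zero)       = y₂∈Y
      triple∈Y (suc (suc zero)) = y₁∈Y

module Characterization (𝔽 : FiniteField) {n k₂ : ℕ} (k<n : suc (suc k₂) < n) (M : Fin (suc (suc (suc k₂))) → LinAlg.Vec 𝔽 n)
            (M-indep : LinAlg.LinIndep 𝔽 M) (M-projective : LinAlg.ProjectiveMatrix 𝔽 M) where
  open FiniteField 𝔽
  open LinAlg 𝔽
  open Cases 𝔽 M M-indep M-projective

  power-positive : ∀ m → 1 ≤ q ^ m
  power-positive = ℕP.m^n>0 q {{FinP.nonZeroIndex (Inverse.from enum 0#)}}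

  gauss-positive : ∀ m → 1 ≤ m → 1 ≤ gauss q m
  gauss-positive (suc m) _ = ℕP.m≤n⇒m≤n+o (gauss q m) (power-positive m)

  N : ℕ
  N = gauss q (suc (suc k₂)) ℕ.* gauss q (n ∸ suc (suc k₂))

  N≥2 : 2 ≤ N
  N≥2 = ℕP.*-mono-≤ (ℕP.+-mono-≤ (power-positive (suc k₂)) (gauss-positive (suc k₂) (s≤s z≤n)))
                    (gauss-positive _ (ℕP.m<n⇒0<n∸m k<n))

  line-avoiding : ∀ {K : Pred n} → HasDim K (suc (suc k₂)) → Σ (Line n (suc (suc k₂))) (λ L → ¬ InLine L K)
  line-avoiding K-dim = L , λ (_ , S⊆K , _) → u∉B (toSpan K-dim u (S⊆K u (Span-member (u ∷ T) zero)))
    where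
    B = basis K-dim
    outside = ∃-outside-Span (Span-HasDim e e-indep) B k<n
    u = proj₁ outside
    u∉B = proj₂ (proj₂ outside)
    T : Fam k₂ n
    T i = B (suc (suc i))
    T-indep : LinIndep T
    T-indep = LinIndep-tail (λ i → B (suc i)) (LinIndep-tail B (basis-indep K-dim))
    L : Line n (suc (suc k₂))
    L = record
      { S = Span (u ∷ T) ; U' = Span (u ∷ B)
      ; dimS = Span-HasDim (u ∷ T)
                 (LinIndep-∷ T u T-indep (λ u∈T → u∉B (Span-mono T B (λ i → Span-member B (suc (suc i))) u u∈T)))
      ; dimU' = Span-HasDim (u ∷ B) (LinIndep-∷ B u (basis-indep K-dim) u∉B)
      ; S⊆U' = Span-mono (u ∷ T) (u ∷ B)
                 (λ { zero → Span-member (u ∷ B) zero ; (suc i) → Span-member (u ∷ B) (suc (suc (suc i))) }) }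

  K₀-dim : HasDim (C M (e zero)) (suc (suc k₂))
  K₀-dim = C-HasDim (e zero) (LinIndep⇒≢0 e e-indep zero)

  L* : Line n (suc (suc k₂))
  L* = proj₁ (line-avoiding K₀-dim)

  -- The N lines through the k-space C(e₀), together with a line missing it, are pairwise distinct.
  AllLines⇒N< : AllLines → ∀ {N'} → ContainedInExactly {n} {suc (suc k₂)} U N' → N < N'
  AllLines⇒N< all (Ls , _ , _ , complete) =
    distinct-lines-≤ (L* ∷ lines₀) distinct Ls (λ i → complete ((L* ∷ lines₀) i) (all ((L* ∷ lines₀) i)))
    where
    through : ExactlyLines (λ L → InLine L (C M (e zero))) N
    through = lines-through-count K₀-dim
    lines₀ : Fin N → Line n (suc (suc k₂))
    lines₀ = proj₁ through
    distinct : ∀ i j → LineEq ((L* ∷ lines₀) i) ((L* ∷ lines₀) j) → i ≡ j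
    distinct zero    zero    _  = refl
    distinct zero    (suc j) eq = ⊥-elim (proj₂ (line-avoiding K₀-dim) (proj₂ (eq _) (proj₁ (proj₂ through) j)))
    distinct (suc i) zero    eq = ⊥-elim (proj₂ (line-avoiding K₀-dim) (proj₁ (eq _) (proj₁ (proj₂ through) i)))
    distinct (suc i) (suc j) eq = cong suc (proj₁ (proj₂ (proj₂ through)) i j eq)

  data Shape : Set₁ where
    dim0  : HasDim ⟨Y⟩ 0 → AllLines → Shape
    dim1  : HasDim ⟨Y⟩ 1 → ContainedInExactly {n} {suc (suc k₂)} U N → Shape
    dim2  : HasDim ⟨Y⟩ 2 → ContainedInExactly {n} {suc (suc k₂)} U 1 → IntervalDescription → Shape
    dim≥3 : (∀ {d} → HasDim ⟨Y⟩ d → 3 ≤ d) → ¬ SomeLine → Shape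

  shape : Shape
  shape with classify
  ... | Y-empty no-Y = dim0 (Y-empty⇒⟨Y⟩-dim0 no-Y) (Y-empty⇒AllLines no-Y)
  ... | Y-rank1 y₁ y₁∈Y Y⊆y₁ = dim1 ⟨Y⟩-dim1 exactly
    where open OneDimensional y₁ y₁∈Y Y⊆y₁
  ... | Y-rank2 y₁ y₂ y₁∈Y y₂∈Y independent Y⊆pair = dim2 ⟨Y⟩-dim2 exactly-one interval
    where open TwoIndependent y₁ y₂ y₁∈Y y₂∈Y independent
          open Spanning Y⊆pair
  ... | Y-rank≥3 y₁ y₂ y₃ y₁∈Y y₂∈Y y₃∈Y independent = dim≥3 ⟨Y⟩-dim≥3 no-line
    where open ThreeIndependent y₁ y₂ y₃ y₁∈Y y₂∈Y y₃∈Y independent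

  N≥1 : 1 ≤ N
  N≥1 = ℕP.≤-trans (s≤s z≤n) N≥2

  N≢1 : ¬ (N ≡ 1)
  N≢1 N≡1 = ℕP.<⇒≱ N≥2 (ℕP.≤-reflexive N≡1)

  distinct-dims : ∀ {a b} → HasDim ⟨Y⟩ a → HasDim ⟨Y⟩ b → ¬ (a ≡ b) → ⊥
  distinct-dims ha hb a≢b = a≢b (dim-unique ha hb)

  exactly⇒some : ∀ {N'} → ContainedInExactly {n} {suc (suc k₂)} U N' → 1 ≤ N' → SomeLine
  exactly⇒some {suc _} (Ls , contained , _) _ = Ls zero , contained zero

  all⇒some : AllLines → SomeLine
  all⇒some all = L* , all L*

  some-line⇔ : Shape → SomeLine ⇔₁ Σ ℕ (λ d → d ≤ 2 × HasDim ⟨Y⟩ d)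
  some-line⇔ (dim0 h all) = (λ _ → 0 , z≤n , h) , (λ _ → all⇒some all)
  some-line⇔ (dim1 h exactly) = (λ _ → 1 , s≤s z≤n , h) , (λ _ → exactly⇒some exactly N≥1)
  some-line⇔ (dim2 h exactly _) = (λ _ → 2 , ℕP.≤-refl , h) , (λ _ → exactly⇒some exactly ℕP.≤-refl)
  some-line⇔ (dim≥3 ≥3 none) =
    (λ some → ⊥-elim (none some)) , (λ (d , d≤2 , h) → ⊥-elim (ℕP.<⇒≱ (ℕP.≤-trans (≥3 h) d≤2) ℕP.≤-refl))

  all-lines⇔ : Shape → AllLines ⇔₁ HasDim ⟨Y⟩ 0
  all-lines⇔ (dim0 h all) = (λ _ → h) , (λ _ → all)
  all-lines⇔ (dim1 h exactly) =
    (λ all → ⊥-elim (ℕP.<-irrefl refl (AllLines⇒N< all exactly))) , (λ h₀ → ⊥-elim (distinct-dims h₀ h λ ()))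
  all-lines⇔ (dim2 h exactly _) =
    (λ all → ⊥-elim (ℕP.<⇒≱ (AllLines⇒N< all exactly) N≥1)) , (λ h₀ → ⊥-elim (distinct-dims h₀ h λ ()))
  all-lines⇔ (dim≥3 ≥3 none) =
    (λ all → ⊥-elim (none (all⇒some all))) , (λ h₀ → ⊥-elim (ℕP.<⇒≱ (≥3 h₀) z≤n))

  exactly-N⇔ : Shape → ContainedInExactly {n} {suc (suc k₂)} U N ⇔₁ HasDim ⟨Y⟩ 1
  exactly-N⇔ (dim0 h all) =
    (λ exactly → ⊥-elim (ℕP.<-irrefl refl (AllLines⇒N< all exactly))) , (λ h₁ → ⊥-elim (distinct-dims h h₁ λ ()))
  exactly-N⇔ (dim1 h exactly) = (λ _ → h) , (λ _ → exactly)
  exactly-N⇔ (dim2 h exactly₁ _) =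
    (λ exactly → ⊥-elim (N≢1 (ExactlyLines-unique exactly exactly₁))) , (λ h₁ → ⊥-elim (distinct-dims h₁ h λ ()))
  exactly-N⇔ (dim≥3 ≥3 none) =
    (λ exactly → ⊥-elim (none (exactly⇒some exactly N≥1))) , (λ h₁ → ⊥-elim (ℕP.<⇒≱ (≥3 h₁) (s≤s z≤n)))

  exactly-1⇔ : Shape → ContainedInExactly {n} {suc (suc k₂)} U 1 ⇔₁ HasDim ⟨Y⟩ 2
  exactly-1⇔ (dim0 h all) =
    (λ exactly → ⊥-elim (ℕP.<⇒≱ (AllLines⇒N< all exactly) N≥1)) , (λ h₂ → ⊥-elim (distinct-dims h h₂ λ ()))
  exactly-1⇔ (dim1 h exactlyN) =
    (λ exactly → ⊥-elim (N≢1 (ExactlyLines-unique exactlyN exactly))) , (λ h₂ → ⊥-elim (distinct-dims h h₂ λ ()))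
  exactly-1⇔ (dim2 h exactly _) = (λ _ → h) , (λ _ → exactly)
  exactly-1⇔ (dim≥3 ≥3 none) =
    (λ exactly → ⊥-elim (none (exactly⇒some exactly ℕP.≤-refl))) , (λ h₂ → ⊥-elim (ℕP.<⇒≱ (≥3 h₂) ℕP.≤-refl))

  interval⇐ : Shape → HasDim ⟨Y⟩ 2 → IntervalDescription
  interval⇐ (dim0 h _)          h₂ = ⊥-elim (distinct-dims h h₂ λ ())
  interval⇐ (dim1 h _)          h₂ = ⊥-elim (distinct-dims h h₂ λ ())
  interval⇐ (dim2 _ _ interval) _  = interval
  interval⇐ (dim≥3 ≥3 _)        h₂ = ⊥-elim (ℕP.<⇒≱ (≥3 h₂) ℕP.≤-refl)

theorem1 : (𝔽 : FiniteField) (n k : ℕ) → 1 < k → k < n ∸ 1 →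
    let open FiniteField 𝔽 using (q) in
    let open LinAlg 𝔽 in
    (M : Fin (suc k) → Vec n) → LinIndep M → ProjectiveMatrix M →
    let U = Span M in
    let ⟨Y⟩ = SpanSet (InY M) in
    ((Σ (Line n k) (λ L → ContainedIn U L)) ⇔₁ (Σ ℕ (λ d → d ≤ 2 × HasDim ⟨Y⟩ d)))
    × (((L : Line n k) → ContainedIn U L) ⇔₁ HasDim ⟨Y⟩ 0)
    × (ContainedInExactly {n} {k} U (gauss q k ℕ.* gauss q (n ∸ k)) ⇔₁ HasDim ⟨Y⟩ 1)
    × (ContainedInExactly {n} {k} U 1 ⇔₁ HasDim ⟨Y⟩ 2)
    × (HasDim ⟨Y⟩ 2 →
         HasDim (⋂C M) (k ∸ 1)
         × ((L : Line n k) → ContainedIn U L →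
              (K : Pred n) → InLine L K ⇔₁ InInterval (⋂C M) U k K))
theorem1 𝔽 n (suc (suc k₂)) (s≤s (s≤s z≤n)) k<n-1 M M-indep M-projective =
  some-line⇔ shape , all-lines⇔ shape , exactly-N⇔ shape , exactly-1⇔ shape , interval⇐ shape
  where open Characterization 𝔽 (ℕP.≤-trans k<n-1 (ℕP.m∸n≤m n 1)) M M-indep M-projective
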